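{- For integers $n,k>0$ and $m\ge 0$, \[ \widehat{\mathcal{B}}_n^{k}(m)=\sum_{j=1}^{n}\binom{n}{j}\sum_{r=0}^{\min(n-j,k-1)}(m+r+1)\,\widehat{\mathcal{B}}_{n-j}^{k-1}(m;r)+\sum_{r=0}^{\min(n,k-1)}(r+1)\,\widehat{\mathcal{B}}_n^{k-1}(m;r). \]
   Context: For $k\in\mathbb{Z}$ the poly-Bernoulli polynomials $B_n^{(k)}(x)$ are defined by $\sum_{n\ge 0}B_n^{(k)}(x)\frac{t^n}{n!}=e^{ -xt}\frac{\mathrm{Li}_k(1-e^{ -t})}{1-e^{ -t}}$, where $\mathrm{Li}_k(z)=\sum_{j\ge1}z^j/j^k$. With $\genfrac{[}{]}{0pt}{}{m}{j}$ the unsigned Stirling numbers of the first kind, set $\widehat{\mathcal{B}}_n^k(m):=\frac{1}{m!}\sum_{j=0}^{m}\genfrac{[}{]}{0pt}{}{m}{j}B_n^{(-k-j)}(m)$ (normalized symmetrized poly-Bernoulli number). Callan sequences: for integers $n,k\ge 0$ let $N=\{1,\dots,n\}\cup\{*\}$ and $K=\{1,\dots,k\}\cup\{*'\}$. A Callan sequence of size $n\times k$ consists of an integer $r\ge 0$, a set partition of $N$ into $r+1$ nonempty blocks $R_1,\dots,R_r,R^*$ with $*\in R^*$, and a set partition of $K$ into $r+1$ nonempty blocks $B_1,\dots,B_r,B^*$ with $*'\in B^*$, arranged as the ordered list of $r$ ordinary pairs $(B_1;R_1)\cdots(B_r;R_r)$ together with the extra pair $(B^*;R^*)$; the order of the ordinary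 pairs matters. An $m$-barred Callan sequence is a Callan sequence together with $m$ indistinguishable bars placed in the $r+1$ gaps before, between and after the ordinary pairs (several bars per gap allowed). $\widehat{\mathcal{B}}_n^k(m;r)$ denotes the number of $m$-barred Callan sequences of size $n\times k$ with exactly $r$ ordinary pairs (for $n=0$ or $k=0$ only $r=0$ occurs and this number is $1$). -}

module Defs where

open import Data.Nat as ℕ using (ℕ; zero; suc; _!)
open import Data.Nat.Properties using (_!≢0; m^n≢0)
open import Data.Integer as ℤ using (ℤ; +_; -[1+_])
open import Data.Rational as ℚ using (ℚ; _+_; _*_; -_; 0ℚ; 1ℚ)
open import Data.Fin using (Fin; zero; suc)
open import Data.Fin.Properties using (_≟_)
open import Data.Vec using (Vec; []; _∷_; allFin)
open import Data.Vec.Relation.Unary.All using (All)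
open import Data.Vec.Relation.Unary.Any using (Any)
open import Data.Product using (Σ; _×_)
open import Relation.Binary.PropositionalEquality using (_≡_)
open import Relation.Nullary.Decidable using (True)
open import Data.Vec.Relation.Unary.All using () renaming (all? to allV?)
open import Data.Vec.Relation.Unary.Any using () renaming (any? to anyV?)

sumℚ : ℕ → (ℕ → ℚ) → ℚ
sumℚ zero    f = 0ℚ
sumℚ (suc n) f = sumℚ n f + f n

ℕ→ℚ : ℕ → ℚ
ℕ→ℚ n = (+ n) ℚ./ 1

powℚ : ℚ → ℕ → ℚ
powℚ q zero    = 1ℚ
powℚ q (suc n) = q * powℚ q n

sgn : ℕ → ℚ
sgn n = powℚ (- 1ℚ) n

inv! : ℕ → ℚ
inv! n = ℚ._/_ (+ 1) (n !) {{n !≢0}}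

-- Formal power series over ℚ in t, as coefficient sequences.

Series : Set
Series = ℕ → ℚ

_⊛_ : Series → Series → Series
(a ⊛ b) n = sumℚ (suc n) (λ i → a i * b (n ℕ.∸ i))

oneS : Series
oneS zero    = 1ℚ
oneS (suc n) = 0ℚ

powS : Series → ℕ → Series
powS a zero    = oneS
powS a (suc i) = a ⊛ powS a i

-- e^{-x t} = Σ (-x)^n t^n / n!
expNeg : ℚ → Series
expNeg x n = powℚ (- x) n * inv! n

oneMinusExpNeg : Series
oneMinusExpNeg zero    = 0ℚ
oneMinusExpNeg (suc n) = - (sgn (suc n) * inv! (suc n))

invPow : (j : ℕ) → .{{ℕ.NonZero j}} → ℤ → ℚ
invPow j (+ k)      = ℚ._/_ (+ 1) (j ℕ.^ k) {{m^n≢0 j k}}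
invPow j -[1+ k ]   = ℕ→ℚ (j ℕ.^ suc k)

-- Li_k(z)/z = Σ_{j≥1} z^{j-1} / j^k, with z = 1 - e^{-t}.
-- Since z^{j-1} has t-order j-1, the coefficient of t^n only receives
-- contributions from j ≤ n+1; the truncation below is exact for t^n.
liOverZTrunc : ℤ → ℕ → Series
liOverZTrunc k N n = sumℚ (suc N) (λ i → powS oneMinusExpNeg i n * invPow (suc i) k)

-- Poly-Bernoulli polynomial B_n^{(k)}(x) = n! [t^n] e^{-xt} Li_k(1-e^{-t})/(1-e^{-t})
polyBernoulli : ℕ → ℤ → ℚ → ℚ
polyBernoulli n k x = ℕ→ℚ (n !) * (expNeg x ⊛ liOverZTrunc k n) n

stirling1 : ℕ → ℕ → ℕ
stirling1 zero    zero    = 1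
stirling1 zero    (suc j) = 0
stirling1 (suc m) zero    = 0
stirling1 (suc m) (suc j) = m ℕ.* stirling1 m (suc j) ℕ.+ stirling1 m j

Bhat : ℕ → ℕ → ℕ → ℚ
Bhat n k m = inv! m * sumℚ (suc m) (λ j →
  ℕ→ℚ (stirling1 m j) * polyBernoulli n (ℤ.- (+ (k ℕ.+ j))) (ℕ→ℚ m))

-- m-barred Callan sequences of size n × k with exactly r ordinary pairs.
--
-- N = {*} ∪ {1..n} is encoded as Fin (suc n) with * = zero; a set partition
-- of N into blocks R^*, R_1, …, R_r (ordered ordinary blocks, * ∈ R^*) is
-- the same as a surjection N → Fin (suc r) sending * to zero (label 0 = R^*,
-- label i = R_i).  Since * ↦ zero is forced, we record only the labels of
-- 1..n, i.e. a vector  Vec (Fin (suc r)) n , and require surjectivity of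
-- zero ∷ v.  Same for K.  Pairing (B_i;R_i) is by equal label i.
-- Bars: m indistinguishable bars in the r+1 gaps = a vector of r+1
-- natural numbers (bars per gap) summing to m.

-- decidable (hence proof-irrelevant) surjectivity of a labelling
Surjective : ∀ {a r} → Vec (Fin r) a → Set
Surjective {r = r} v = True (allV? (λ y → anyV? (λ x → y ≟ x) v) (allFin r))

sumV : ∀ {a} → Vec ℕ a → ℕ
sumV []       = 0
sumV (x ∷ xs) = x ℕ.+ sumV xs

BarredCallan : (n k m r : ℕ) → Set
BarredCallan n k m r =
  (Σ (Vec (Fin (suc r)) n) λ ρ → Surjective (zero ∷ ρ)) ×
  (Σ (Vec (Fin (suc r)) k) λ β → Surjective (zero ∷ β)) ×
  (Σ (Vec ℕ (suc r)) λ bars → True (sumV bars ℕ.≟ m))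

-- Both sides are evaluated through S(n,r) = surj n r, the number of labellings of
-- {1..n} by {0..r} that hit every label together with * ↦ 0 (r! S₂(n+1,r+1)).
--  1. Counting: explicit bijections give B̂_n^k(m;r) = S(n,r) S(k,r) C(m+r,r).
--  2. Closed form: with z = 1 - e^{-t}, B_n^{(-t)}(x) = n! [t^n] e^{-xt} Σ_i (i+1)^t z^i.
--     Stirling numbers of the first kind turn (1/m!) Σ_j [m j] (i+1)^{k+j} into
--     (i+1)^k C(i+m,m) = Σ_r S(k,r) C(i,r) C(i+m,m), and G_r = e^{-mt} Σ_i C(i,r) C(i+m,m) z^i
--     solves a differential recurrence giving n! [t^n] G_r = S(n,r) C(m+r,r).  Hence
--     B̂_n^k(m) = Σ_r S(k,r) S(n,r) C(m+r,r).
--  3. Recurrence: S(k,r) = (r+1) S(k-1,r) + r S(k-1,r-1) splits this sum into the two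
--     sums of the theorem, using Σ_j C(n,j+1) S(n-1-j,r) = S(n,r+1) for the first.
module Submission where

open import Algebra.Bundles using (CommutativeSemiring)
open import Data.Nat using (ℕ; zero; suc; _≤_; _<_; _≤′_; ≤′-refl; ≤′-step)
open import Data.Nat.Properties using (≤-refl; m<n⇒m<1+n; ≤⇒≤′; ≤′⇒≤)

-- The laws hold for any
-- operator satisfying Σ 0 f ≈ 0 and Σ (n+1) f ≈ Σ n f + f n, so they apply verbatim
-- to sumℚ from the definitions and to its ℕ counterpart.
module FiniteSums {c ℓ} (R : CommutativeSemiring c ℓ) where

  open CommutativeSemiring R hiding (zero)
  open import Algebra.Properties.CommutativeSemigroup +-commutativeSemigroup using (interchange)
  open import Relation.Binary.Reasoning.Setoid setoid

  module Laws
    (sum : ℕ → (ℕ → Carrier) → Carrier)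
    (sum-zero : ∀ f → sum zero f ≈ 0#)
    (sum-suc : ∀ n f → sum (suc n) f ≈ sum n f + f n)
    where

    sum-cong : ∀ n {f g : ℕ → Carrier} → (∀ i → i < n → f i ≈ g i) → sum n f ≈ sum n g
    sum-cong zero {f} {g} _ = trans (sum-zero f) (sym (sum-zero g))
    sum-cong (suc n) {f} {g} f≈g = begin
      sum (suc n) f   ≈⟨ sum-suc n f ⟩
      sum n f + f n   ≈⟨ +-cong (sum-cong n (λ i i<n → f≈g i (m<n⇒m<1+n i<n))) (f≈g n ≤-refl) ⟩
      sum n g + g n   ≈⟨ sym (sum-suc n g) ⟩
      sum (suc n) g   ∎

    sum-zeros : ∀ n (f : ℕ → Carrier) → (∀ i → i < n → f i ≈ 0#) → sum n f ≈ 0#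
    sum-zeros zero f _ = sum-zero f
    sum-zeros (suc n) f f≈0 = begin
      sum (suc n) f   ≈⟨ sum-suc n f ⟩
      sum n f + f n   ≈⟨ +-cong (sum-zeros n f (λ i i<n → f≈0 i (m<n⇒m<1+n i<n))) (f≈0 n ≤-refl) ⟩
      0# + 0#         ≈⟨ +-identityˡ 0# ⟩
      0#              ∎

    sum-+ : ∀ n (f g : ℕ → Carrier) → sum n (λ i → f i + g i) ≈ sum n f + sum n g
    sum-+ zero f g = begin
      sum zero (λ i → f i + g i)   ≈⟨ sum-zero _ ⟩
      0#                           ≈⟨ sym (+-identityˡ 0#) ⟩
      0# + 0#                      ≈⟨ sym (+-cong (sum-zero f) (sum-zero g)) ⟩
      sum zero f + sum zero g      ∎
    sum-+ (suc n) f g = begin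
      sum (suc n) (λ i → f i + g i)        ≈⟨ sum-suc n _ ⟩
      sum n (λ i → f i + g i) + (f n + g n) ≈⟨ +-congʳ (sum-+ n f g) ⟩
      (sum n f + sum n g) + (f n + g n)     ≈⟨ interchange _ _ _ _ ⟩
      (sum n f + f n) + (sum n g + g n)     ≈⟨ sym (+-cong (sum-suc n f) (sum-suc n g)) ⟩
      sum (suc n) f + sum (suc n) g         ∎

    sum-*ˡ : ∀ n a (f : ℕ → Carrier) → sum n (λ i → a * f i) ≈ a * sum n f
    sum-*ˡ zero a f = begin
      sum zero (λ i → a * f i)  ≈⟨ sum-zero _ ⟩
      0#                        ≈⟨ sym (zeroʳ a) ⟩
      a * 0#                    ≈⟨ sym (*-congˡ (sum-zero f)) ⟩
      a * sum zero f            ∎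
    sum-*ˡ (suc n) a f = begin
      sum (suc n) (λ i → a * f i)        ≈⟨ sum-suc n _ ⟩
      sum n (λ i → a * f i) + a * f n    ≈⟨ +-congʳ (sum-*ˡ n a f) ⟩
      a * sum n f + a * f n              ≈⟨ sym (distribˡ a (sum n f) (f n)) ⟩
      a * (sum n f + f n)                ≈⟨ sym (*-congˡ (sum-suc n f)) ⟩
      a * sum (suc n) f                  ∎

    sum-first : ∀ n (f : ℕ → Carrier) → sum (suc n) f ≈ f 0 + sum n (λ i → f (suc i))
    sum-first zero f = begin
      sum 1 f              ≈⟨ sum-suc 0 f ⟩
      sum 0 f + f 0        ≈⟨ +-congʳ (sum-zero f) ⟩
      0# + f 0             ≈⟨ +-comm 0# (f 0) ⟩
      f 0 + 0#             ≈⟨ sym (+-congˡ (sum-zero _)) ⟩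
      f 0 + sum 0 (λ i → f (suc i)) ∎
    sum-first (suc n) f = begin
      sum (suc (suc n)) f                                   ≈⟨ sum-suc (suc n) f ⟩
      sum (suc n) f + f (suc n)                             ≈⟨ +-congʳ (sum-first n f) ⟩
      (f 0 + sum n (λ i → f (suc i))) + f (suc n)           ≈⟨ +-assoc _ _ _ ⟩
      f 0 + (sum n (λ i → f (suc i)) + f (suc n))           ≈⟨ sym (+-congˡ (sum-suc n _)) ⟩
      f 0 + sum (suc n) (λ i → f (suc i))                   ∎

    sum-swap : ∀ n m (f : ℕ → ℕ → Carrier) →
               sum n (λ i → sum m (f i)) ≈ sum m (λ j → sum n (λ i → f i j))
    sum-swap zero m f = begin
      sum zero (λ i → sum m (f i))                  ≈⟨ sum-zero _ ⟩
      0#                                            ≈⟨ sym (sum-zeros m _ (λ j _ → sum-zero _)) ⟩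
      sum m (λ j → sum zero (λ i → f i j))          ∎
    sum-swap (suc n) m f = begin
      sum (suc n) (λ i → sum m (f i))                           ≈⟨ sum-suc n _ ⟩
      sum n (λ i → sum m (f i)) + sum m (f n)                   ≈⟨ +-congʳ (sum-swap n m f) ⟩
      sum m (λ j → sum n (λ i → f i j)) + sum m (f n)           ≈⟨ sym (sum-+ m _ _) ⟩
      sum m (λ j → sum n (λ i → f i j) + f n j)                 ≈⟨ sum-cong m (λ j _ → sym (sum-suc n _)) ⟩
      sum m (λ j → sum (suc n) (λ i → f i j))                   ∎

    sum-tail : ∀ {a b} (f : ℕ → Carrier) → a ≤ b → (∀ i → a ≤ i → i < b → f i ≈ 0#) → sum b f ≈ sum a f
    sum-tail {a} f a≤b vanish = go (≤⇒≤′ a≤b) vanish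
      where
      go : ∀ {b} → a ≤′ b → (∀ i → a ≤ i → i < b → f i ≈ 0#) → sum b f ≈ sum a f
      go ≤′-refl _ = refl
      go (≤′-step {b} a≤′b) vanish = begin
        sum (suc b) f   ≈⟨ sum-suc b f ⟩
        sum b f + f b   ≈⟨ +-cong (go a≤′b (λ i a≤i i<b → vanish i a≤i (m<n⇒m<1+n i<b)))
                                  (vanish b (≤′⇒≤ a≤′b) ≤-refl) ⟩
        sum a f + 0#    ≈⟨ +-identityʳ _ ⟩
        sum a f         ∎

module Naturals where

  open import Data.Nat using (ℕ; zero; suc; _+_)
  open import Data.Nat.Properties using (+-*-commutativeSemiring)
  open import Relation.Binary.PropositionalEquality using (refl)

  sumℕ : ℕ → (ℕ → ℕ) → ℕ
  sumℕ zero    f = 0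
  sumℕ (suc n) f = sumℕ n f + f n

  module ℕΣ = FiniteSums.Laws +-*-commutativeSemiring sumℕ (λ _ → refl) (λ _ _ → refl)

module Rationals where

  open import Data.Maybe.Base using (Maybe; just; nothing)
  open import Relation.Nullary using (yes; no)
  open import Data.Nat as ℕ using (ℕ; zero; suc; _!)
  open import Data.Nat.Properties as ℕP using (_!≢0)
  open import Data.Integer as ℤ using (+_)
  import Data.Integer.Properties as ℤP
  open import Data.Rational as ℚ using (ℚ; mkℚ; _+_; _*_; 0ℚ; 1ℚ)
  open import Data.Rational.Properties as ℚP using (+-*-commutativeRing)
  import Data.Nat.Coprimality as Coprimality
  open import Level using (0ℓ)
  open import Relation.Binary.PropositionalEquality
  import Tactic.RingSolver.Core.AlmostCommutativeRing as ACR
  open import Algebra.Bundles using (CommutativeRing)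
  open import Tactic.RingSolver using (solve-∀)
  open import Defs using (sumℚ; ℕ→ℚ; inv!)
  open Naturals using (sumℕ)
  open ≡-Reasoning

  ringℚ : ACR.AlmostCommutativeRing 0ℓ 0ℓ
  ringℚ = ACR.fromCommutativeRing +-*-commutativeRing isZero
    where
    isZero : (x : ℚ) → Maybe (0ℚ ≡ x)
    isZero x with 0ℚ ℚP.≟ x
    ... | yes p = just p
    ... | no _  = nothing

  module ℚΣ = FiniteSums.Laws (CommutativeRing.commutativeSemiring +-*-commutativeRing)
                sumℚ (λ _ → refl) (λ _ _ → refl)

  ℕ→ℚ-mkℚ : ∀ n → ℕ→ℚ n ≡ mkℚ (+ n) 0 (Coprimality.sym (Coprimality.1-coprimeTo n))
  ℕ→ℚ-mkℚ n = ℚP.normalize-coprime _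

  ℕ→ℚ-+ : ∀ a b → ℕ→ℚ (a ℕ.+ b) ≡ ℕ→ℚ a + ℕ→ℚ b
  ℕ→ℚ-+ a b rewrite ℕ→ℚ-mkℚ a | ℕ→ℚ-mkℚ b =
    cong (ℚ._/ 1) (sym (cong₂ ℤ._+_ (ℤP.*-identityʳ (+ a)) (ℤP.*-identityʳ (+ b))))

  ℕ→ℚ-* : ∀ a b → ℕ→ℚ (a ℕ.* b) ≡ ℕ→ℚ a * ℕ→ℚ b
  ℕ→ℚ-* a b rewrite ℕ→ℚ-mkℚ a | ℕ→ℚ-mkℚ b = cong (ℚ._/ 1) (sym (ℤP.+◃n≡+n (a ℕ.* b)))

  ℕ→ℚ-sum : ∀ n (f : ℕ → ℕ) → ℕ→ℚ (sumℕ n f) ≡ sumℚ n (λ i → ℕ→ℚ (f i))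
  ℕ→ℚ-sum zero    f = refl
  ℕ→ℚ-sum (suc n) f = trans (ℕ→ℚ-+ (sumℕ n f) (f n)) (cong (_+ ℕ→ℚ (f n)) (ℕ→ℚ-sum n f))

  ℕ→ℚ-dot : ∀ N (a f : ℕ → ℕ) → sumℚ N (λ r → ℕ→ℚ (a r) * ℕ→ℚ (f r)) ≡ ℕ→ℚ (sumℕ N (λ r → a r ℕ.* f r))
  ℕ→ℚ-dot N a f = trans (ℚΣ.sum-cong N (λ r _ → sym (ℕ→ℚ-* (a r) (f r)))) (sym (ℕ→ℚ-sum N _))

  ℕ→ℚ-inverse : ∀ d .{{_ : ℕ.NonZero d}} → ℕ→ℚ d * ((+ 1) ℚ./ d) ≡ 1ℚ
  ℕ→ℚ-inverse (suc d) rewrite ℕ→ℚ-mkℚ (suc d)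
                            | ℚP.normalize-coprime {1} {d} (Coprimality.1-coprimeTo (suc d)) =
    ℚP.*-inverseʳ (mkℚ (+ suc d) 0 (Coprimality.sym (Coprimality.1-coprimeTo (suc d))))

  n!*inv!n : ∀ n → ℕ→ℚ (n !) * inv! n ≡ 1ℚ
  n!*inv!n n = ℕ→ℚ-inverse (n !) {{n !≢0}}

  inv!-step : ∀ n → ℕ→ℚ (suc n) * inv! (suc n) ≡ inv! n
  inv!-step n = begin
    x                                              ≡⟨ sym (ℚP.*-identityˡ x) ⟩
    1ℚ * x                                         ≡⟨ cong (_* x) (sym (n!*inv!n n)) ⟩
    (ℕ→ℚ (n !) * inv! n) * x                      ≡⟨ swap (ℕ→ℚ (n !)) (inv! n) (ℕ→ℚ (suc n)) (inv! (suc n)) ⟩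
    (ℕ→ℚ (suc n) * ℕ→ℚ (n !) * inv! (suc n)) * inv! n
                                                   ≡⟨ cong (λ y → y * inv! (suc n) * inv! n) (sym (ℕ→ℚ-* (suc n) (n !))) ⟩
    (ℕ→ℚ (suc n !) * inv! (suc n)) * inv! n       ≡⟨ cong (_* inv! n) (n!*inv!n (suc n)) ⟩
    1ℚ * inv! n                                    ≡⟨ ℚP.*-identityˡ (inv! n) ⟩
    inv! n                                         ∎
    where
    x : ℚ
    x = ℕ→ℚ (suc n) * inv! (suc n)
    swap : ∀ a b c d → (a * b) * (c * d) ≡ (c * a * d) * b
    swap = solve-∀ ringℚ

module Binomials where

  open import Data.Nat
  open import Data.Nat.Properties
  open import Data.Nat.Tactic.RingSolver using (solve-∀)
  open import Data.Nat.Combinatorics using (_C_; nCk+nC[k+1]≡[n+1]C[k+1])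
  open import Relation.Binary.PropositionalEquality
  open ≡-Reasoning

  binom : ℕ → ℕ → ℕ
  binom n       zero    = 1
  binom zero    (suc k) = 0
  binom (suc n) (suc k) = binom n k + binom n (suc k)

  binom≡C : ∀ n k → binom n k ≡ n C k
  binom≡C n       zero    = sym (nC0 n)
    where
    nC0 : ∀ n → n C 0 ≡ 1
    nC0 zero    = refl
    nC0 (suc n) = refl
  binom≡C zero    (suc k) = refl
  binom≡C (suc n) (suc k) =
    trans (cong₂ _+_ (binom≡C n k) (binom≡C n (suc k))) (nCk+nC[k+1]≡[n+1]C[k+1] n k)

  binom-vanish : ∀ n k → n < k → binom n k ≡ 0
  binom-vanish zero    (suc k) _         = refl
  binom-vanish (suc n) (suc k) (s≤s n<k)
    rewrite binom-vanish n k n<k | binom-vanish n (suc k) (m<n⇒m<1+n n<k) = refl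

  binom-diag : ∀ n → binom n n ≡ 1
  binom-diag zero    = refl
  binom-diag (suc n) rewrite binom-diag n | binom-vanish n (suc n) ≤-refl = refl

  binom-one : ∀ n → binom n 1 ≡ n
  binom-one zero    = refl
  binom-one (suc n) rewrite binom-one n = refl

  absorption : ∀ n k → suc n * binom n k ≡ suc k * binom (suc n) (suc k)
  absorption zero    zero    = refl
  absorption zero    (suc k) = sym (*-zeroʳ (suc (suc k)))
  absorption (suc n) zero rewrite binom-one n = ring n
    where ring : ∀ n → suc (suc n) * 1 ≡ 1 * (1 + (1 + n))
          ring = solve-∀
  absorption (suc n) (suc k) = begin
    suc (suc n) * (binom n k + binom n (suc k))
      ≡⟨ expand (binom n k) (binom n (suc k)) n ⟩
    (suc n * binom n k + binom n k) + (suc n * binom n (suc k) + binom n (suc k))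
      ≡⟨ cong₂ (λ a b → (a + binom n k) + (b + binom n (suc k))) (absorption n k) (absorption n (suc k)) ⟩
    (suc k * binom (suc n) (suc k) + binom n k)
      + (suc (suc k) * binom (suc n) (suc (suc k)) + binom n (suc k))
      ≡⟨ collect k (binom n k) (binom n (suc k)) (binom n (suc (suc k))) ⟩
    suc (suc k) * (binom (suc n) (suc k) + binom (suc n) (suc (suc k)))  ∎
    where
    expand : ∀ a b n → suc (suc n) * (a + b) ≡ (suc n * a + a) + (suc n * b + b)
    expand = solve-∀
    collect : ∀ k a b c → (suc k * (a + b) + a) + (suc (suc k) * (b + c) + b)
                          ≡ suc (suc k) * ((a + b) + (b + c))
    collect = solve-∀

  binom-sym : ∀ a b → binom (a + b) a ≡ binom (a + b) b
  binom-sym zero    zero    = refl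
  binom-sym zero    (suc b) = sym (binom-diag (suc b))
  binom-sym (suc a) zero rewrite +-identityʳ a = binom-diag (suc a)
  binom-sym (suc a) (suc b) = begin
    binom (a + suc b) a + binom (a + suc b) (suc a)
      ≡⟨ cong₂ _+_ (binom-sym a (suc b))
                   (trans (cong (λ x → binom x (suc a)) (+-suc a b)) (binom-sym (suc a) b)) ⟩
    binom (a + suc b) (suc b) + binom (suc a + b) b
      ≡⟨ cong (λ x → binom (a + suc b) (suc b) + binom x b) (sym (+-suc a b)) ⟩
    binom (a + suc b) (suc b) + binom (a + suc b) b
      ≡⟨ +-comm (binom (a + suc b) (suc b)) _ ⟩
    binom (a + suc b) b + binom (a + suc b) (suc b)  ∎

  binom-step : ∀ i m → suc i * binom (suc i + m) m ≡ suc (i + m) * binom (i + m) m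
  binom-step i m = begin
    suc i * binom (suc i + m) m          ≡⟨ cong (suc i *_) (sym (binom-sym (suc i) m)) ⟩
    suc i * binom (suc (i + m)) (suc i)  ≡⟨ sym (absorption (i + m) i) ⟩
    suc (i + m) * binom (i + m) i        ≡⟨ cong (suc (i + m) *_) (binom-sym i m) ⟩
    suc (i + m) * binom (i + m) m        ∎

  absorption′ : ∀ m r → (m + suc r) * binom (m + r) r ≡ suc r * binom (m + suc r) (suc r)
  absorption′ m r rewrite +-suc m r = absorption (m + r) r

  -- number of ways to distribute m indistinguishable bars into r+1 gaps,
  -- by whether the first gap is empty
  compositions : ℕ → ℕ → ℕ
  compositions m       zero    = 1
  compositions zero    (suc r) = 1
  compositions (suc m) (suc r) = compositions (suc m) r + compositions m (suc r)

  compositions≡binom : ∀ m r → compositions m r ≡ binom (m + r) r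
  compositions≡binom m       zero    = refl
  compositions≡binom zero    (suc r) = sym (binom-diag (suc r))
  compositions≡binom (suc m) (suc r)
    rewrite compositions≡binom (suc m) r | compositions≡binom m (suc r) | +-suc m r = refl

-- Surjection numbers.  cover n s d counts words of length n over an alphabet
-- of s "required" and d "optional" letters in which every required letter
-- occurs; surj n r = cover n r 1 counts labellings ρ of {1..n} by {0..r}
-- such that 0 ∷ ρ hits every label, i.e. r! S₂(n+1, r+1).
module SurjectionNumbers where

  open import Data.Nat
  open import Data.Nat.Properties
  open import Data.Nat.Tactic.RingSolver using (solve-∀)
  open import Relation.Binary.PropositionalEquality
  open ≡-Reasoning
  open Naturals
  open Binomials

  cover : ℕ → ℕ → ℕ → ℕ
  cover zero    zero    d = 1
  cover zero    (suc s) d = 0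
  cover (suc n) zero    d = d * cover n zero d
  cover (suc n) (suc s) d = suc s * cover n s (suc d) + d * cover n (suc s) d

  -- an optional letter either occurs (and may be declared required) or not
  cover-split : ∀ n s d → cover n s (suc d) ≡ cover n (suc s) d + cover n s d
  cover-split zero    zero    d = refl
  cover-split zero    (suc s) d = refl
  cover-split (suc n) zero    d rewrite cover-split n zero d = ring (cover n 1 d) (cover n 0 d) d
    where ring : ∀ a b d → suc d * (a + b) ≡ (1 * (a + b) + d * a) + d * b
          ring = solve-∀
  cover-split (suc n) (suc s) d rewrite cover-split n s (suc d) | cover-split n (suc s) d =
    ring (cover n (suc (suc s)) d) (cover n (suc s) d) (cover n s (suc d)) s d
    where ring : ∀ a b c s d → suc s * ((a + b) + c) + suc d * (a + b)
                               ≡ (suc (suc s) * (a + b) + d * a) + (suc s * c + d * b)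
          ring = solve-∀

  -- a word of length n cannot contain more than n required letters
  cover-vanish : ∀ n s d → n < s → cover n s d ≡ 0
  cover-vanish zero    (suc s) d _ = refl
  cover-vanish (suc n) (suc s) d (s≤s n<s)
    rewrite cover-vanish n s (suc d) n<s | cover-vanish n (suc s) d (m<n⇒m<1+n n<s) =
    cong₂ _+_ (*-zeroʳ s) (*-zeroʳ d)

  -- labels 1..r are required, label 0 is optional (it is hit by * anyway)
  surj : ℕ → ℕ → ℕ
  surj n r = cover n r 1

  surj-vanish : ∀ n r → n < r → surj n r ≡ 0
  surj-vanish n r = cover-vanish n r 1

  surj-zero : ∀ n → surj n 0 ≡ 1
  surj-zero zero    = refl
  surj-zero (suc n) rewrite surj-zero n = refl

  -- the label of the first element is either used again or not:
  --   S(n+1, r) = (r+1) S(n, r) + r S(n, r-1)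
  surj-rec : ∀ n r → surj (suc n) r ≡ suc r * surj n r + r * surj n (pred r)
  surj-rec n zero = ring (surj n 0)
    where ring : ∀ a → 1 * a ≡ 1 * a + 0 * a
          ring = solve-∀
  surj-rec n (suc r) rewrite cover-split n r 1 = ring (cover n (suc r) 1) (cover n r 1) r
    where ring : ∀ a b r → suc r * (a + b) + 1 * a ≡ suc (suc r) * a + suc r * b
          ring = solve-∀

  sum-pred : ∀ n (g : ℕ → ℕ → ℕ) → sumℕ (suc n) (λ r → r * g (pred r) r) ≡ sumℕ n (λ r → suc r * g r (suc r))
  sum-pred n g = ℕΣ.sum-first n (λ r → r * g (pred r) r)

  surj-rec-sum : ∀ k (h : ℕ → ℕ) →
    sumℕ (suc (suc k)) (λ r → surj (suc k) r * h r)
    ≡ sumℕ (suc k) (λ r → suc r * surj k r * (h r + h (suc r)))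
  surj-rec-sum k h = begin
    sumℕ (suc (suc k)) (λ r → surj (suc k) r * h r)
      ≡⟨ ℕΣ.sum-cong (suc (suc k)) (λ r _ → trans (cong (_* h r) (surj-rec k r))
                                                  (*-distribʳ-+ (h r) (suc r * surj k r) _)) ⟩
    sumℕ (suc (suc k)) (λ r → suc r * surj k r * h r + r * surj k (pred r) * h r)
      ≡⟨ ℕΣ.sum-+ (suc (suc k)) _ _ ⟩
    sumℕ (suc (suc k)) (λ r → suc r * surj k r * h r) + sumℕ (suc (suc k)) (λ r → r * surj k (pred r) * h r)
      ≡⟨ cong₂ _+_ (ℕΣ.sum-tail _ (n≤1+n (suc k)) (λ r k<r _ → vanish r k<r))
                   (trans (ℕΣ.sum-cong (suc (suc k)) (λ r _ → *-assoc r _ _))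
                          (sum-pred (suc k) (λ q r → surj k q * h r))) ⟩
    sumℕ (suc k) (λ r → suc r * surj k r * h r) + sumℕ (suc k) (λ r → suc r * (surj k r * h (suc r)))
      ≡⟨ sym (ℕΣ.sum-+ (suc k) _ _) ⟩
    sumℕ (suc k) (λ r → suc r * surj k r * h r + suc r * (surj k r * h (suc r)))
      ≡⟨ ℕΣ.sum-cong (suc k) (λ r _ → ring (suc r) (surj k r) (h r) (h (suc r))) ⟩
    sumℕ (suc k) (λ r → suc r * surj k r * (h r + h (suc r)))  ∎
    where
    vanish : ∀ r → suc k ≤ r → suc r * surj k r * h r ≡ 0
    vanish r k<r rewrite surj-vanish k r k<r | *-zeroʳ (suc r) = refl
    ring : ∀ s a x y → s * a * x + s * (a * y) ≡ s * a * (x + y)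
    ring = solve-∀

  -- (i+1)^k = Σ_r S(k, r) C(i, r): a map {1..k} → {0..i} is determined by the
  -- r-set of its nonzero values and a labelling hitting all of them
  pow-surj : ∀ k i → suc i ^ k ≡ sumℕ (suc k) (λ r → surj k r * binom i r)
  pow-surj zero    i = refl
  pow-surj (suc k) i = begin
    suc i * suc i ^ k
      ≡⟨ cong (suc i *_) (pow-surj k i) ⟩
    suc i * sumℕ (suc k) (λ r → surj k r * binom i r)
      ≡⟨ sym (ℕΣ.sum-*ˡ (suc k) (suc i) _) ⟩
    sumℕ (suc k) (λ r → suc i * (surj k r * binom i r))
      ≡⟨ ℕΣ.sum-cong (suc k) (λ r _ → absorb r) ⟩
    sumℕ (suc k) (λ r → suc r * surj k r * (binom i r + binom i (suc r)))
      ≡⟨ sym (surj-rec-sum k (binom i)) ⟩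
    sumℕ (suc (suc k)) (λ r → surj (suc k) r * binom i r)  ∎
    where
    absorb : ∀ r → suc i * (surj k r * binom i r) ≡ suc r * surj k r * (binom i r + binom i (suc r))
    absorb r = begin
      suc i * (surj k r * binom i r)   ≡⟨ ring₁ (suc i) (surj k r) (binom i r) ⟩
      surj k r * (suc i * binom i r)   ≡⟨ cong (surj k r *_) (absorption i r) ⟩
      surj k r * (suc r * binom (suc i) (suc r))  ≡⟨ ring₂ (surj k r) (suc r) _ ⟩
      suc r * surj k r * (binom i r + binom i (suc r))  ∎
      where
      ring₁ : ∀ a b c → a * (b * c) ≡ b * (a * c)
      ring₁ = solve-∀
      ring₂ : ∀ a b c → a * (b * c) ≡ b * a * c
      ring₂ = solve-∀

  ∸-suc : ∀ n j → j < n → n ∸ j ≡ suc (n ∸ suc j)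
  ∸-suc (suc n) zero    _         = refl
  ∸-suc (suc n) (suc j) (s≤s j<n) = ∸-suc n j j<n

  -- classify the labellings counted by surj n (r+1) by the set of j+1
  -- elements carrying the last label:
  --   Σ_{j<n} C(n, j+1) S(n-1-j, r) = S(n, r+1)
  surj-by-block : ∀ n r → sumℕ n (λ j → binom n (suc j) * surj (n ∸ suc j) r) ≡ surj n (suc r)
  surj-by-block zero    r = refl
  surj-by-block (suc n) r = begin
    sumℕ (suc n) (λ j → binom (suc n) (suc j) * surj (n ∸ j) r)
      ≡⟨ ℕΣ.sum-cong (suc n) (λ j _ → *-distribʳ-+ (surj (n ∸ j) r) (binom n j) (binom n (suc j))) ⟩
    sumℕ (suc n) (λ j → binom n j * surj (n ∸ j) r + binom n (suc j) * surj (n ∸ j) r)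
      ≡⟨ ℕΣ.sum-+ (suc n) _ _ ⟩
    sumℕ (suc n) (λ j → binom n j * surj (n ∸ j) r) + sumℕ (suc n) (λ j → binom n (suc j) * surj (n ∸ j) r)
      ≡⟨ cong₂ _+_ lower upper ⟩
    (surj n r + surj n (suc r)) + (suc r * surj n (suc r) + r * surj n r)
      ≡⟨ ring (surj n r) (surj n (suc r)) r ⟩
    suc (suc r) * surj n (suc r) + suc r * surj n r
      ≡⟨ sym (surj-rec n (suc r)) ⟩
    surj (suc n) (suc r)  ∎
    where
    ring : ∀ a b r → (a + b) + (suc r * b + r * a) ≡ suc (suc r) * b + suc r * a
    ring = solve-∀
    -- the block is empty (j = 0) or not
    lower : sumℕ (suc n) (λ j → binom n j * surj (n ∸ j) r) ≡ surj n r + surj n (suc r)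
    lower = trans (ℕΣ.sum-first n _) (cong₂ _+_ (+-identityʳ (surj n r)) (surj-by-block n r))
    upper : sumℕ (suc n) (λ j → binom n (suc j) * surj (n ∸ j) r) ≡ suc r * surj n (suc r) + r * surj n r
    upper = begin
      sumℕ (suc n) (λ j → binom n (suc j) * surj (n ∸ j) r)
        ≡⟨ cong (sumℕ n (λ j → binom n (suc j) * surj (n ∸ j) r) +_)
                (cong (_* surj (n ∸ n) r) (binom-vanish n (suc n) ≤-refl)) ⟩
      sumℕ n (λ j → binom n (suc j) * surj (n ∸ j) r) + 0
        ≡⟨ +-identityʳ _ ⟩
      sumℕ n (λ j → binom n (suc j) * surj (n ∸ j) r)
        ≡⟨ ℕΣ.sum-cong n (λ j j<n → cong (λ x → binom n (suc j) * surj x r) (∸-suc n j j<n)) ⟩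
      sumℕ n (λ j → binom n (suc j) * surj (suc (n ∸ suc j)) r)
        ≡⟨ ℕΣ.sum-cong n (λ j _ → trans (cong (binom n (suc j) *_) (surj-rec (n ∸ suc j) r))
                                        (distrib (binom n (suc j)) r _ _)) ⟩
      sumℕ n (λ j → suc r * (binom n (suc j) * surj (n ∸ suc j) r)
                    + r * (binom n (suc j) * surj (n ∸ suc j) (pred r)))
        ≡⟨ ℕΣ.sum-+ n _ _ ⟩
      sumℕ n (λ j → suc r * (binom n (suc j) * surj (n ∸ suc j) r))
        + sumℕ n (λ j → r * (binom n (suc j) * surj (n ∸ suc j) (pred r)))
        ≡⟨ cong₂ _+_ (ℕΣ.sum-*ˡ n (suc r) _) (ℕΣ.sum-*ˡ n r _) ⟩
      suc r * sumℕ n (λ j → binom n (suc j) * surj (n ∸ suc j) r)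
        + r * sumℕ n (λ j → binom n (suc j) * surj (n ∸ suc j) (pred r))
        ≡⟨ cong₂ (λ x y → suc r * x + r * y) (surj-by-block n r) (surj-by-block n (pred r)) ⟩
      suc r * surj n (suc r) + r * surj n (suc (pred r))
        ≡⟨ cong (suc r * surj n (suc r) +_) (r*pred r) ⟩
      suc r * surj n (suc r) + r * surj n r  ∎
      where
      distrib : ∀ b r x y → b * (suc r * x + r * y) ≡ suc r * (b * x) + r * (b * y)
      distrib = solve-∀
      r*pred : ∀ r → r * surj n (suc (pred r)) ≡ r * surj n r
      r*pred zero    = refl
      r*pred (suc _) = refl

module RisingFactorials where

  open import Data.Nat
  open import Data.Nat.Properties
  open import Data.Nat.Tactic.RingSolver using (solve-∀)
  open import Relation.Binary.PropositionalEquality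
  open ≡-Reasoning
  open import Defs using (stirling1)
  open Naturals
  open Binomials

  rising : ℕ → ℕ → ℕ
  rising y zero    = 1
  rising y (suc m) = rising y m * (y + m)

  stirling1-vanish : ∀ m j → m < j → stirling1 m j ≡ 0
  stirling1-vanish zero    (suc j) _ = refl
  stirling1-vanish (suc m) (suc j) (s≤s m<j)
    rewrite stirling1-vanish m (suc j) (m<n⇒m<1+n m<j) | stirling1-vanish m j m<j =
    trans (+-identityʳ _) (*-zeroʳ m)

  m*stirling1-0 : ∀ m → m * stirling1 m 0 ≡ 0
  m*stirling1-0 zero    = refl
  m*stirling1-0 (suc m) = *-zeroʳ (suc m)

  stirling1-rising : ∀ m y → sumℕ (suc m) (λ j → stirling1 m j * y ^ j) ≡ rising y m
  stirling1-rising zero    y = refl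
  stirling1-rising (suc m) y = begin
    sumℕ (suc (suc m)) (λ j → stirling1 (suc m) j * y ^ j)
      ≡⟨ ℕΣ.sum-first (suc m) _ ⟩
    sumℕ (suc m) (λ j → (m * stirling1 m (suc j) + stirling1 m j) * (y * y ^ j))
      ≡⟨ ℕΣ.sum-cong (suc m) (λ j _ → distrib (stirling1 m (suc j)) (stirling1 m j) m y (y ^ j)) ⟩
    sumℕ (suc m) (λ j → m * (stirling1 m (suc j) * (y * y ^ j)) + y * (stirling1 m j * y ^ j))
      ≡⟨ ℕΣ.sum-+ (suc m) _ _ ⟩
    sumℕ (suc m) (λ j → m * (stirling1 m (suc j) * (y * y ^ j)))
      + sumℕ (suc m) (λ j → y * (stirling1 m j * y ^ j))
      ≡⟨ cong₂ _+_ (ℕΣ.sum-*ˡ (suc m) m _) (ℕΣ.sum-*ˡ (suc m) y _) ⟩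
    m * shifted + y * sumℕ (suc m) (λ j → stirling1 m j * y ^ j)
      ≡⟨ cong₂ _+_ m*shifted (cong (y *_) (stirling1-rising m y)) ⟩
    m * rising y m + y * rising y m
      ≡⟨ collect m y (rising y m) ⟩
    rising y m * (y + m)  ∎
    where
    shifted : ℕ
    shifted = sumℕ (suc m) (λ j → stirling1 m (suc j) * (y * y ^ j))
    distrib : ∀ a b m y z → (m * a + b) * (y * z) ≡ m * (a * (y * z)) + y * (b * z)
    distrib = solve-∀
    collect : ∀ m y r → m * r + y * r ≡ r * (y + m)
    collect = solve-∀
    -- the index shift is harmless: the missing term [m 0] only matters for m = 0
    m*shifted : m * shifted ≡ m * rising y m
    m*shifted = begin
      m * shifted                            ≡⟨ cong (_+ m * shifted) (sym (m*stirling1-0 m)) ⟩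
      m * stirling1 m 0 + m * shifted        ≡⟨ sym (*-distribˡ-+ m _ _) ⟩
      m * (stirling1 m 0 + shifted)          ≡⟨ cong (λ x → m * (x + shifted)) (sym (*-identityʳ (stirling1 m 0))) ⟩
      m * (stirling1 m 0 * 1 + shifted)      ≡⟨ cong (m *_) (sym (ℕΣ.sum-first (suc m) _)) ⟩
      m * sumℕ (suc (suc m)) (λ j → stirling1 m j * y ^ j)
        ≡⟨ cong (m *_) (ℕΣ.sum-tail _ (n≤1+n (suc m)) (λ j m<j _ →
             cong (_* y ^ j) (stirling1-vanish m j m<j))) ⟩
      m * sumℕ (suc m) (λ j → stirling1 m j * y ^ j)
        ≡⟨ cong (m *_) (stirling1-rising m y) ⟩
      m * rising y m  ∎

  rising-binom : ∀ i m → rising (suc i) m ≡ m ! * binom (i + m) m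
  rising-binom i zero    = refl
  rising-binom i (suc m) = begin
    rising (suc i) m * (suc i + m)                  ≡⟨ cong (_* (suc i + m)) (rising-binom i m) ⟩
    m ! * binom (i + m) m * suc (i + m)             ≡⟨ ring₁ (m !) (binom (i + m) m) (i + m) ⟩
    m ! * (suc (i + m) * binom (i + m) m)           ≡⟨ cong (m ! *_) (absorption (i + m) m) ⟩
    m ! * (suc m * binom (suc (i + m)) (suc m))     ≡⟨ ring₂ (m !) m _ ⟩
    (suc m * m !) * binom (suc (i + m)) (suc m)     ≡⟨ cong (λ x → (suc m * m !) * binom x (suc m)) (sym (+-suc i m)) ⟩
    (suc m * m !) * binom (i + suc m) (suc m)       ∎
    where
    ring₁ : ∀ f b x → f * b * suc x ≡ f * (suc x * b)
    ring₁ = solve-∀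
    ring₂ : ∀ f m b → f * (suc m * b) ≡ (suc m * f) * b
    ring₂ = solve-∀

  stirling1-powers : ∀ k m i → sumℕ (suc m) (λ j → stirling1 m j * suc i ^ (k + j))
                               ≡ m ! * (suc i ^ k * binom (i + m) m)
  stirling1-powers k m i = begin
    sumℕ (suc m) (λ j → stirling1 m j * suc i ^ (k + j))
      ≡⟨ ℕΣ.sum-cong (suc m) (λ j _ → trans (cong (stirling1 m j *_) (^-distribˡ-+-* (suc i) k j))
                                           (ring₁ (stirling1 m j) (suc i ^ k) (suc i ^ j))) ⟩
    sumℕ (suc m) (λ j → suc i ^ k * (stirling1 m j * suc i ^ j))
      ≡⟨ ℕΣ.sum-*ˡ (suc m) (suc i ^ k) _ ⟩
    suc i ^ k * sumℕ (suc m) (λ j → stirling1 m j * suc i ^ j)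
      ≡⟨ cong (suc i ^ k *_) (trans (stirling1-rising m (suc i)) (rising-binom i m)) ⟩
    suc i ^ k * (m ! * binom (i + m) m)
      ≡⟨ ring₁ (suc i ^ k) (m !) (binom (i + m) m) ⟩
    m ! * (suc i ^ k * binom (i + m) m)  ∎
    where
    ring₁ : ∀ a b c → a * (b * c) ≡ b * (a * c)
    ring₁ = solve-∀

module Counting where

  open import Data.Nat using (ℕ; zero; suc; _+_; _*_; _≡ᵇ_; pred)
  import Data.Nat.Properties as ℕP
  open import Data.Nat.Tactic.RingSolver using (solve-∀)
  open import Data.Bool using (Bool; true; false; T; not; if_then_else_)
  open import Data.Unit using (tt)
  open import Data.Empty using (⊥; ⊥-elim)
  open import Data.Fin using (Fin; zero; suc)
  open import Data.Fin.Properties using (_≟_; +↔⊎; *↔×)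
  open import Data.Fin.Permutation using (↔⇒≡)
  open import Data.Vec using (Vec; []; _∷_)
  open import Data.Vec.Membership.Propositional using (_∈_)
  open import Data.Vec.Relation.Unary.Any using (here; there)
  open import Data.Vec.Relation.Unary.All.Properties using (tabulate⁺; tabulate⁻)
  open import Data.Product using (Σ; _×_; _,_)
  open import Data.Product.Function.NonDependent.Propositional using (_×-↔_)
  open import Data.Product.Function.Dependent.Propositional using (Σ-↔)
  open import Data.Sum using (_⊎_; inj₁; inj₂)
  open import Data.Sum.Function.Propositional using (_⊎-↔_)
  open import Function.Bundles using (_↔_; _⇔_; mk↔ₛ′; mk⇔; Equivalence)
  open import Function.Properties.Inverse using (↔-refl; ↔-sym; ↔-trans)
  open import Relation.Binary.PropositionalEquality
  open import Relation.Nullary using (yes; no; does)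
  open import Relation.Nullary.Decidable using (True; toWitness; fromWitness; isYes≗does; dec-false)
  open import Defs using (Surjective; sumV; BarredCallan)
  open Binomials using (compositions)
  open SurjectionNumbers using (cover; surj)

  -- boolean guards are proof-irrelevant, so logically equivalent guards
  -- carve out subsets in bijection
  T-irrelevant : ∀ {b} (x y : T b) → x ≡ y
  T-irrelevant {true} tt tt = refl

  T-⇔⇒↔ : ∀ {b c} → T b ⇔ T c → T b ↔ T c
  T-⇔⇒↔ b⇔c = mk↔ₛ′ (Equivalence.to b⇔c) (Equivalence.from b⇔c)
                     (λ _ → T-irrelevant _ _) (λ _ → T-irrelevant _ _)

  Σ-T-⇔ : ∀ {A : Set} (p p′ : A → Bool) → (∀ a → T (p a) ⇔ T (p′ a)) →
          Σ A (λ a → T (p a)) ↔ Σ A (λ a → T (p′ a))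
  Σ-T-⇔ p p′ p⇔p′ = Σ-↔ ↔-refl (T-⇔⇒↔ (p⇔p′ _))

  sumFin : ∀ q → (Fin q → ℕ) → ℕ
  sumFin zero    g = 0
  sumFin (suc q) g = g zero + sumFin q (λ x → g (suc x))

  Fin-sumFin : ∀ q (g : Fin q → ℕ) → Fin (sumFin q g) ↔ Σ (Fin q) (λ x → Fin (g x))
  Fin-sumFin zero    g = mk↔ₛ′ (λ ()) (λ { (() , _) }) (λ { (() , _) }) (λ ())
  Fin-sumFin (suc q) g =
    ↔-trans +↔⊎ (↔-trans (↔-refl ⊎-↔ Fin-sumFin q (λ x → g (suc x))) first-or-rest)
    where
    first-or-rest : (Fin (g zero) ⊎ Σ (Fin q) (λ x → Fin (g (suc x)))) ↔ Σ (Fin (suc q)) (λ x → Fin (g x))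
    first-or-rest = mk↔ₛ′
      (λ { (inj₁ a) → zero , a ; (inj₂ (x , b)) → suc x , b })
      (λ { (zero , a) → inj₁ a ; (suc x , b) → inj₂ (x , b) })
      (λ { (zero , a) → refl ; (suc x , b) → refl })
      (λ { (inj₁ a) → refl ; (inj₂ (x , b)) → refl })

  bit : Bool → ℕ
  bit true  = 1
  bit false = 0

  Fin-bit : ∀ b → Fin (bit b) ↔ T b
  Fin-bit true  = mk↔ₛ′ (λ _ → tt) (λ _ → zero) (λ _ → refl) (λ { zero → refl })
  Fin-bit false = mk↔ₛ′ (λ ()) (λ ()) (λ ()) (λ ())

  count : ∀ {q} n → (Vec (Fin q) n → Bool) → ℕ
  count         zero    p = bit (p [])
  count {q = q} (suc n) p = sumFin q (λ x → count n (λ v → p (x ∷ v)))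

  Fin-count : ∀ {q} n (p : Vec (Fin q) n → Bool) → Fin (count n p) ↔ Σ (Vec (Fin q) n) (λ v → T (p v))
  Fin-count zero p = ↔-trans (Fin-bit (p []))
    (mk↔ₛ′ ([] ,_) (λ { ([] , t) → t }) (λ { ([] , t) → refl }) (λ _ → refl))
  Fin-count {q} (suc n) p =
    ↔-trans (Fin-sumFin q _) (↔-trans (Σ-↔ ↔-refl (Fin-count n _)) uncons)
    where
    uncons : Σ (Fin q) (λ x → Σ (Vec (Fin q) n) (λ v → T (p (x ∷ v)))) ↔ Σ (Vec (Fin q) (suc n)) (λ v → T (p v))
    uncons = mk↔ₛ′ (λ { (x , v , t) → (x ∷ v) , t }) (λ { ((x ∷ v) , t) → x , v , t })
                   (λ { ((x ∷ v) , t) → refl }) (λ { (x , v , t) → refl })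

  size : ∀ {q} → (Fin q → Bool) → ℕ
  size {q} S = sumFin q (λ y → bit (S y))

  csize : ∀ {q} → (Fin q → Bool) → ℕ
  csize S = size (λ y → not (S y))

  remove : ∀ {q} → Fin q → (Fin q → Bool) → (Fin q → Bool)
  remove x S y = if does (y ≟ x) then false else S y

  -- v covers S: every letter of S occurs in v (checked by crossing off letters)
  covers : ∀ {q n} → (Fin q → Bool) → Vec (Fin q) n → Bool
  covers S []      = size S ≡ᵇ 0
  covers S (x ∷ v) = covers (remove x S) v

  size-remove : ∀ {q} (x : Fin q) S → size (remove x S) + bit (S x) ≡ size S
  size-remove zero    S = ℕP.+-comm (size (λ y → S (suc y))) (bit (S zero))
  size-remove (suc x) S = trans (ℕP.+-assoc (bit (S zero)) _ _)
                                (cong (bit (S zero) +_) (size-remove x (λ y → S (suc y))))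

  csize-remove : ∀ {q} (x : Fin q) S → csize (remove x S) ≡ bit (S x) + csize S
  csize-remove zero S with S zero
  ... | true  = refl
  ... | false = refl
  csize-remove (suc x) S =
    trans (cong (bit (not (S zero)) +_) (csize-remove x (λ y → S (suc y))))
          (swap (bit (not (S zero))) (bit (S (suc x))) (csize (λ y → S (suc y))))
    where swap : ∀ a b c → a + (b + c) ≡ b + (a + c)
          swap = solve-∀

  sumFin-cong : ∀ q {g g′ : Fin q → ℕ} → (∀ x → g x ≡ g′ x) → sumFin q g ≡ sumFin q g′
  sumFin-cong zero    _   = refl
  sumFin-cong (suc q) g≡g′ = cong₂ _+_ (g≡g′ zero) (sumFin-cong q (λ x → g≡g′ (suc x)))

  sumFin-if : ∀ {q} (S : Fin q → Bool) a b → sumFin q (λ x → if S x then a else b) ≡ size S * a + csize S * b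
  sumFin-if {zero}  S a b = refl
  sumFin-if {suc q} S a b with S zero
  ... | true  rewrite sumFin-if (λ y → S (suc y)) a b = ring a (size (λ y → S (suc y))) (csize (λ y → S (suc y))) b
    where ring : ∀ a s c b → a + (s * a + c * b) ≡ (1 + s) * a + (0 + c) * b
          ring = solve-∀
  ... | false rewrite sumFin-if (λ y → S (suc y)) a b = ring a (size (λ y → S (suc y))) (csize (λ y → S (suc y))) b
    where ring : ∀ a s c b → b + (s * a + c * b) ≡ (0 + s) * a + (1 + c) * b
          ring = solve-∀

  count-covers : ∀ {q} n (S : Fin q → Bool) → count n (covers S) ≡ cover n (size S) (csize S)
  count-covers zero S with size S
  ... | zero  = refl
  ... | suc _ = refl
  count-covers {q} (suc n) S = begin
    sumFin q (λ x → count n (covers (remove x S)))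
      ≡⟨ sumFin-cong q (λ x → trans (count-covers n (remove x S)) (first-letter x)) ⟩
    sumFin q (λ x → if S x then cover n (pred (size S)) (suc (csize S)) else cover n (size S) (csize S))
      ≡⟨ sumFin-if S _ _ ⟩
    size S * cover n (pred (size S)) (suc (csize S)) + csize S * cover n (size S) (csize S)
      ≡⟨ recurrence (size S) (csize S) ⟩
    cover (suc n) (size S) (csize S)  ∎
    where
    open ≡-Reasoning
    recurrence : ∀ s d → s * cover n (pred s) (suc d) + d * cover n s d ≡ cover (suc n) s d
    recurrence zero    d = refl
    recurrence (suc s) d = refl
    -- a required first letter becomes optional; an optional one changes nothing
    first-letter : ∀ x → cover n (size (remove x S)) (csize (remove x S))
                   ≡ (if S x then cover n (pred (size S)) (suc (csize S)) else cover n (size S) (csize S))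
    first-letter x with S x | size-remove x S | csize-remove x S
    ... | true  | e₁ | e₂ rewrite sym e₁ | e₂ | ℕP.+-comm (size (remove x S)) 1 = refl
    ... | false | e₁ | e₂ rewrite sym e₁ | e₂ | ℕP.+-identityʳ (size (remove x S)) = refl

  size-nonempty : ∀ {q} (S : Fin q → Bool) y → T (S y) → T (size S ≡ᵇ 0) → ⊥
  size-nonempty S zero    Sy empty with S zero
  ... | true = empty
  size-nonempty S (suc y) Sy empty with S zero
  ... | true  = empty
  ... | false = size-nonempty (λ z → S (suc z)) y Sy empty

  size-empty : ∀ {q} (S : Fin q → Bool) → (∀ y → T (S y) → ⊥) → T (size S ≡ᵇ 0)
  size-empty {zero}  S _    = tt
  size-empty {suc q} S none with S zero | none zero
  ... | true  | not-S0 = ⊥-elim (not-S0 tt)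
  ... | false | _      = size-empty (λ y → S (suc y)) (λ y → none (suc y))

  remove-other : ∀ {q} {x y : Fin q} S → y ≢ x → remove x S y ≡ S y
  remove-other {x = x} {y} S y≢x = cong (λ b → if b then false else S y) (dec-false (y ≟ x) y≢x)

  covers-sound : ∀ {q n} (S : Fin q → Bool) (v : Vec (Fin q) n) → T (covers S v) → ∀ y → T (S y) → y ∈ v
  covers-sound S []      c y Sy = ⊥-elim (size-nonempty S y Sy c)
  covers-sound S (x ∷ v) c y Sy with y ≟ x
  ... | yes y≡x = here y≡x
  ... | no  y≢x = there (covers-sound (remove x S) v c y (subst T (sym (remove-other S y≢x)) Sy))

  covers-complete : ∀ {q n} (S : Fin q → Bool) (v : Vec (Fin q) n) → (∀ y → T (S y) → y ∈ v) → T (covers S v)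
  covers-complete S []      cov = size-empty S (λ y Sy → case-[] (cov y Sy))
    where case-[] : ∀ {y} → y ∈ [] → ⊥
          case-[] ()
  covers-complete S (x ∷ v) cov = covers-complete (remove x S) v cov′
    where
    cov′ : ∀ y → T (remove x S y) → y ∈ v
    cov′ y Ry with y ≟ x
    ... | yes _   = ⊥-elim Ry
    ... | no  y≢x with cov y Ry
    ...   | here y≡x  = ⊥-elim (y≢x y≡x)
    ...   | there y∈v = y∈v

  -- the labels that a labelling ρ must hit (label 0 is hit by * anyway)
  nonzero : ∀ {r} → Fin (suc r) → Bool
  nonzero zero    = false
  nonzero (suc _) = true

  size-all : ∀ r → size {r} (λ _ → true) ≡ r
  size-all zero    = refl
  size-all (suc r) = cong suc (size-all r)

  csize-all : ∀ r → csize {r} (λ _ → true) ≡ 0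
  csize-all zero    = refl
  csize-all (suc r) = csize-all r

  surjective⇔covers : ∀ {r n} (ρ : Vec (Fin (suc r)) n) → T (covers nonzero ρ) ⇔ Surjective (zero ∷ ρ)
  surjective⇔covers {r} ρ = mk⇔
    (λ c → fromWitness (tabulate⁺ (hit c)))
    (λ s → covers-complete nonzero ρ (λ y → required (tabulate⁻ (toWitness s)) y))
    where
    hit : T (covers nonzero ρ) → ∀ y → y ∈ zero ∷ ρ
    hit c zero    = here refl
    hit c (suc y) = there (covers-sound nonzero ρ c (suc y) tt)
    required : (∀ y → y ∈ zero ∷ ρ) → ∀ y → T (nonzero y) → y ∈ ρ
    required all (suc y) _ with all (suc y)
    ... | there y∈ρ = y∈ρ

  Fin-≡ : ∀ {a b} → a ≡ b → Fin a ↔ Fin b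
  Fin-≡ refl = ↔-refl

  Fin-surj : ∀ n r → Fin (surj n r) ↔ Σ (Vec (Fin (suc r)) n) (λ ρ → Surjective (zero ∷ ρ))
  Fin-surj n r = ↔-trans (Fin-≡ surj≡count) (↔-trans (Fin-count n (covers nonzero))
                   (Σ-T-⇔ (covers nonzero) _ surjective⇔covers))
    where
    surj≡count : surj n r ≡ count n (covers (nonzero {r}))
    surj≡count = sym (trans (count-covers n nonzero)
                            (cong₂ (cover n) (size-all r) (cong suc (csize-all r))))

  -- placements of m bars into r+1 gaps, recorded as the numbers of bars per gap
  Bars : ℕ → ℕ → Set
  Bars m r = Σ (Vec ℕ (suc r)) (λ b → T (sumV b ≡ᵇ m))

  Bars-≡ : ∀ {m r} {b b′ : Vec ℕ (suc r)} (t : T (sumV b ≡ᵇ m)) (t′ : T (sumV b′ ≡ᵇ m)) →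
           b ≡ b′ → _≡_ {A = Bars m r} (b , t) (b′ , t′)
  Bars-≡ t t′ refl = cong (_ ,_) (T-irrelevant t t′)

  zeros : ∀ n → Vec ℕ n
  zeros zero    = []
  zeros (suc n) = 0 ∷ zeros n

  sum-zeros : ∀ {n} (v : Vec ℕ n) → sumV v ≡ 0 → v ≡ zeros n
  sum-zeros []           _ = refl
  sum-zeros (zero ∷ v) e = cong (0 ∷_) (sum-zeros v e)

  sumV-zeros : ∀ n → sumV (zeros n) ≡ 0
  sumV-zeros zero    = refl
  sumV-zeros (suc n) = sumV-zeros n

  -- the first gap is empty or not
  Fin-Bars : ∀ m r → Fin (compositions m r) ↔ Bars m r
  Fin-Bars m zero = mk↔ₛ′
    (λ _ → (m ∷ []) , ℕP.≡⇒≡ᵇ (m + 0) m (ℕP.+-identityʳ m))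
    (λ _ → zero)
    (λ { ((x ∷ []) , t) → Bars-≡ _ t (cong (_∷ []) (trans (sym (ℕP.≡ᵇ⇒≡ (x + 0) m t)) (ℕP.+-identityʳ x))) })
    (λ { zero → refl })
  Fin-Bars zero (suc r) = mk↔ₛ′
    (λ _ → zeros (suc (suc r)) , ℕP.≡⇒≡ᵇ (sumV (zeros (suc (suc r)))) 0 (sumV-zeros (suc (suc r))))
    (λ _ → zero)
    (λ { (b , t) → Bars-≡ _ t (sym (sum-zeros b (ℕP.≡ᵇ⇒≡ (sumV b) 0 t))) })
    (λ { zero → refl })
  Fin-Bars (suc m) (suc r) =
    ↔-trans +↔⊎ (↔-trans (Fin-Bars (suc m) r ⊎-↔ Fin-Bars m (suc r)) first-gap)
    where
    first-gap : (Bars (suc m) r ⊎ Bars m (suc r)) ↔ Bars (suc m) (suc r)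
    first-gap = mk↔ₛ′
      (λ { (inj₁ (b , t)) → (0 ∷ b) , t ; (inj₂ ((h ∷ b) , t)) → (suc h ∷ b) , t })
      (λ { ((zero ∷ b) , t) → inj₁ (b , t) ; ((suc h ∷ b) , t) → inj₂ ((h ∷ b) , t) })
      (λ { ((zero ∷ b) , t) → refl ; ((suc h ∷ b) , t) → refl })
      (λ { (inj₁ (b , t)) → refl ; (inj₂ ((h ∷ b) , t)) → refl })

  Fin-BarredCallan : ∀ n k m r → Fin (surj n r * (surj k r * compositions m r)) ↔ BarredCallan n k m r
  Fin-BarredCallan n k m r =
    ↔-trans *↔× (Fin-surj n r ×-↔ ↔-trans *↔× (Fin-surj k r ×-↔ bars))
    where
    bars : Fin (compositions m r) ↔ Σ (Vec ℕ (suc r)) (λ b → True (sumV b ℕP.≟ m))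
    bars = ↔-trans (Fin-Bars m r)
             (Σ-T-⇔ _ _ (λ b → mk⇔ (subst T (sym (isYes≗does (sumV b ℕP.≟ m))))
                                  (subst T (isYes≗does (sumV b ℕP.≟ m)))))

  barredCallan-count : (cnt : ℕ → ℕ → ℕ → ℕ → ℕ) → (∀ n k m r → Fin (cnt n k m r) ↔ BarredCallan n k m r) →
                       ∀ n k m r → cnt n k m r ≡ surj n r * (surj k r * compositions m r)
  barredCallan-count cnt Fin-cnt n k m r =
    ↔⇒≡ (↔-trans (Fin-cnt n k m r) (↔-sym (Fin-BarredCallan n k m r)))

module PowerSeries where

  open import Data.Nat as ℕ using (ℕ; zero; suc; _∸_; _<_; _≤_; pred)
  import Data.Nat.Properties as ℕP
  open import Data.Rational as ℚ using (ℚ; _+_; _*_; -_; _-_; 0ℚ; 1ℚ)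
  import Data.Rational.Properties as ℚP
  open import Relation.Binary.PropositionalEquality
  open import Tactic.RingSolver using (solve-∀)
  open ≡-Reasoning
  open import Defs
  open Rationals

  record Linear (L : (ℕ → ℚ) → ℚ) : Set where
    field
      congL       : ∀ {c d} → (∀ i → c i ≡ d i) → L c ≡ L d
      additive    : ∀ c d → L (λ i → c i + d i) ≡ L c + L d
      homogeneous : ∀ α c → L (λ i → α * c i) ≡ α * L c

    negation : ∀ c → L (λ i → - c i) ≡ - L c
    negation c = begin
      L (λ i → - c i)           ≡⟨ congL (λ i → neg (c i)) ⟩
      L (λ i → (- 1ℚ) * c i)    ≡⟨ homogeneous (- 1ℚ) c ⟩
      (- 1ℚ) * L c              ≡⟨ sym (neg (L c)) ⟩
      - L c                     ∎
      where neg : ∀ x → - x ≡ (- 1ℚ) * x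
            neg = solve-∀ ringℚ

    subtractive : ∀ c d → L (λ i → c i - d i) ≡ L c - L d
    subtractive c d = trans (additive c (λ i → - d i)) (cong (L c +_) (negation d))

    combination : ∀ N (a : ℕ → ℚ) (f : ℕ → ℕ → ℚ) →
                  L (λ i → sumℚ N (λ t → a t * f t i)) ≡ sumℚ N (λ t → a t * L (f t))
    combination zero    a f = begin
      L (λ i → 0ℚ)              ≡⟨ congL (λ _ → sym (ℚP.*-zeroˡ 0ℚ)) ⟩
      L (λ i → 0ℚ * 0ℚ)         ≡⟨ homogeneous 0ℚ (λ _ → 0ℚ) ⟩
      0ℚ * L (λ i → 0ℚ)         ≡⟨ ℚP.*-zeroˡ (L (λ i → 0ℚ)) ⟩
      0ℚ                        ∎
    combination (suc N) a f = begin
      L (λ i → sumℚ N (λ t → a t * f t i) + a N * f N i)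
        ≡⟨ additive _ _ ⟩
      L (λ i → sumℚ N (λ t → a t * f t i)) + L (λ i → a N * f N i)
        ≡⟨ cong₂ _+_ (combination N a f) (homogeneous (a N) (f N)) ⟩
      sumℚ N (λ t → a t * L (f t)) + a N * L (f N)  ∎

  evaluation : ∀ j → Linear (λ c → c j)
  evaluation j = record { congL = λ c≡d → c≡d j ; additive = λ _ _ → refl ; homogeneous = λ _ _ → refl }

  weighted : ∀ N (w : ℕ → ℚ) (L : ℕ → (ℕ → ℚ) → ℚ) → (∀ j → Linear (L j)) →
             Linear (λ c → sumℚ N (λ j → w j * L j c))
  weighted N w L lin = record
    { congL       = λ c≡d → ℚΣ.sum-cong N (λ j _ → cong (w j *_) (Linear.congL (lin j) c≡d))
    ; additive    = λ c d → trans (ℚΣ.sum-cong N (λ j _ → trans (cong (w j *_) (Linear.additive (lin j) c d))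
                                                                (ℚP.*-distribˡ-+ (w j) _ _)))
                                  (ℚΣ.sum-+ N _ _)
    ; homogeneous = λ α c → trans (ℚΣ.sum-cong N (λ j _ → trans (cong (w j *_) (Linear.homogeneous (lin j) α c))
                                                                (swap (w j) α _)))
                                  (ℚΣ.sum-*ˡ N α _)
    }
    where swap : ∀ x y z → x * (y * z) ≡ y * (x * z)
          swap = solve-∀ ringℚ

  transfer : ∀ {L L′} → Linear L → (∀ c → L c ≡ L′ c) → Linear L′
  transfer {L} {L′} lin L≡L′ = record
    { congL       = λ {c} {d} c≡d → trans (sym (L≡L′ c)) (trans (congL c≡d) (L≡L′ d))
    ; additive    = λ c d → trans (sym (L≡L′ _)) (trans (additive c d) (cong₂ _+_ (L≡L′ c) (L≡L′ d)))
    ; homogeneous = λ α c → trans (sym (L≡L′ _)) (trans (homogeneous α c) (cong (α *_) (L≡L′ c)))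
    }
    where open Linear lin

  ⊛-linearʳ : ∀ (a : Series) n → Linear (λ b → (a ⊛ b) n)
  ⊛-linearʳ a n = weighted (suc n) a (λ i b → b (n ∸ i)) (λ i → evaluation (n ∸ i))

  ⊛-linearˡ : ∀ (b : Series) n → Linear (λ a → (a ⊛ b) n)
  ⊛-linearˡ b n = transfer (weighted (suc n) (λ i → b (n ∸ i)) (λ i a → a i) evaluation)
                           (λ a → ℚΣ.sum-cong (suc n) (λ i _ → ℚP.*-comm (b (n ∸ i)) (a i)))

  ⊛-congʳ : ∀ (a b b′ : Series) n → (∀ j → j ≤ n → b j ≡ b′ j) → (a ⊛ b) n ≡ (a ⊛ b′) n
  ⊛-congʳ a b b′ n b≡b′ = ℚΣ.sum-cong (suc n) (λ i _ → cong (a i *_) (b≡b′ (n ∸ i) (ℕP.m∸n≤m n i)))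

  oneS-⊛ : ∀ (a : Series) n → (oneS ⊛ a) n ≡ a n
  oneS-⊛ a n = begin
    (oneS ⊛ a) n                                     ≡⟨ ℚΣ.sum-first n _ ⟩
    1ℚ * a n + sumℚ n (λ i → 0ℚ * a (n ∸ suc i))      ≡⟨ cong₂ _+_ (ℚP.*-identityˡ (a n))
                                                               (ℚΣ.sum-zeros n _ (λ i _ → ℚP.*-zeroˡ (a (n ∸ suc i)))) ⟩
    a n + 0ℚ                                         ≡⟨ ℚP.+-identityʳ (a n) ⟩
    a n                                              ∎

  D : Series → Series
  D a n = ℕ→ℚ (suc n) * a (suc n)

  product-rule : ∀ (a b : Series) n → D (a ⊛ b) n ≡ (D a ⊛ b) n + (a ⊛ D b) n
  product-rule a b n = begin
    ℕ→ℚ (suc n) * sumℚ (suc (suc n)) (λ i → a i * b (suc n ∸ i))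
      ≡⟨ sym (ℚΣ.sum-*ˡ (suc (suc n)) (ℕ→ℚ (suc n)) _) ⟩
    sumℚ (suc (suc n)) (λ i → ℕ→ℚ (suc n) * (a i * b (suc n ∸ i)))
      ≡⟨ ℚΣ.sum-cong (suc (suc n)) (λ i i<2+n → split i (ℕ.s≤s⁻¹ i<2+n)) ⟩
    sumℚ (suc (suc n)) (λ i → ℕ→ℚ i * a i * b (suc n ∸ i) + a i * (ℕ→ℚ (suc n ∸ i) * b (suc n ∸ i)))
      ≡⟨ ℚΣ.sum-+ (suc (suc n)) _ _ ⟩
    sumℚ (suc (suc n)) (λ i → ℕ→ℚ i * a i * b (suc n ∸ i))
      + sumℚ (suc (suc n)) (λ i → a i * (ℕ→ℚ (suc n ∸ i) * b (suc n ∸ i)))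
      ≡⟨ cong₂ _+_ left right ⟩
    (D a ⊛ b) n + (a ⊛ D b) n  ∎
    where
    -- n+1 = i + (n+1-i) distributes the factor n+1 over the two factors
    split : ∀ i → i ≤ suc n → ℕ→ℚ (suc n) * (a i * b (suc n ∸ i))
                             ≡ ℕ→ℚ i * a i * b (suc n ∸ i) + a i * (ℕ→ℚ (suc n ∸ i) * b (suc n ∸ i))
    split i i≤1+n = begin
      ℕ→ℚ (suc n) * (a i * b (suc n ∸ i))
        ≡⟨ cong (λ x → ℕ→ℚ x * (a i * b (suc n ∸ i))) (sym (ℕP.m+[n∸m]≡n i≤1+n)) ⟩
      ℕ→ℚ (i ℕ.+ (suc n ∸ i)) * (a i * b (suc n ∸ i))
        ≡⟨ cong (_* (a i * b (suc n ∸ i))) (ℕ→ℚ-+ i (suc n ∸ i)) ⟩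
      (ℕ→ℚ i + ℕ→ℚ (suc n ∸ i)) * (a i * b (suc n ∸ i))
        ≡⟨ distrib (ℕ→ℚ i) (ℕ→ℚ (suc n ∸ i)) (a i) (b (suc n ∸ i)) ⟩
      ℕ→ℚ i * a i * b (suc n ∸ i) + a i * (ℕ→ℚ (suc n ∸ i) * b (suc n ∸ i))  ∎
      where distrib : ∀ x y p q → (x + y) * (p * q) ≡ x * p * q + p * (y * q)
            distrib = solve-∀ ringℚ
    -- the i = 0 summand vanishes, the others are the coefficients of D a ⊛ b
    left : sumℚ (suc (suc n)) (λ i → ℕ→ℚ i * a i * b (suc n ∸ i)) ≡ (D a ⊛ b) n
    left = begin
      sumℚ (suc (suc n)) (λ i → ℕ→ℚ i * a i * b (suc n ∸ i))
        ≡⟨ ℚΣ.sum-first (suc n) _ ⟩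
      0ℚ * a 0 * b (suc n) + (D a ⊛ b) n
        ≡⟨ cong (_+ (D a ⊛ b) n) (trans (cong (_* b (suc n)) (ℚP.*-zeroˡ (a 0))) (ℚP.*-zeroˡ (b (suc n)))) ⟩
      0ℚ + (D a ⊛ b) n
        ≡⟨ ℚP.+-identityˡ _ ⟩
      (D a ⊛ b) n  ∎
    -- the i = n+1 summand vanishes, the others are the coefficients of a ⊛ D b
    right : sumℚ (suc (suc n)) (λ i → a i * (ℕ→ℚ (suc n ∸ i) * b (suc n ∸ i))) ≡ (a ⊛ D b) n
    right = begin
      sumℚ (suc n) (λ i → a i * (ℕ→ℚ (suc n ∸ i) * b (suc n ∸ i)))
        + a (suc n) * (ℕ→ℚ (suc n ∸ suc n) * b (suc n ∸ suc n))
        ≡⟨ cong (sumℚ (suc n) (λ i → a i * (ℕ→ℚ (suc n ∸ i) * b (suc n ∸ i))) +_) last ⟩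
      sumℚ (suc n) (λ i → a i * (ℕ→ℚ (suc n ∸ i) * b (suc n ∸ i))) + 0ℚ
        ≡⟨ ℚP.+-identityʳ _ ⟩
      sumℚ (suc n) (λ i → a i * (ℕ→ℚ (suc n ∸ i) * b (suc n ∸ i)))
        ≡⟨ ℚΣ.sum-cong (suc n) (λ i i<1+n → cong (λ x → a i * (ℕ→ℚ x * b x)) (ℕP.+-∸-assoc 1 (ℕ.s≤s⁻¹ i<1+n))) ⟩
      (a ⊛ D b) n  ∎
      where
      last : a (suc n) * (ℕ→ℚ (suc n ∸ suc n) * b (suc n ∸ suc n)) ≡ 0ℚ
      last rewrite ℕP.n∸n≡0 n = trans (cong (a (suc n) *_) (ℚP.*-zeroˡ (b 0))) (ℚP.*-zeroʳ (a (suc n)))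

  D-expNeg : ∀ x n → D (expNeg x) n ≡ (- x) * expNeg x n
  D-expNeg x n = begin
    ℕ→ℚ (suc n) * ((- x) * powℚ (- x) n * inv! (suc n))
      ≡⟨ regroup (ℕ→ℚ (suc n)) (- x) (powℚ (- x) n) (inv! (suc n)) ⟩
    (- x) * (powℚ (- x) n * (ℕ→ℚ (suc n) * inv! (suc n)))
      ≡⟨ cong (λ t → (- x) * (powℚ (- x) n * t)) (inv!-step n) ⟩
    (- x) * (powℚ (- x) n * inv! n)  ∎
    where regroup : ∀ a y p i → a * (y * p * i) ≡ y * (p * (a * i))
          regroup = solve-∀ ringℚ

  -- the series z = 1 - e^{-t} in which Li_k(z)/z is expanded
  z : Series
  z = oneMinusExpNeg

  -- D (1 - e^{-t}) = e^{-t} = 1 - (1 - e^{-t})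
  D-z : ∀ n → D z n ≡ oneS n - z n
  D-z zero    = refl
  D-z (suc m) = begin
    ℕ→ℚ (suc (suc m)) * (- ((- 1ℚ * sgn (suc m)) * inv! (suc (suc m))))
      ≡⟨ regroup (ℕ→ℚ (suc (suc m))) (sgn (suc m)) (inv! (suc (suc m))) ⟩
    sgn (suc m) * (ℕ→ℚ (suc (suc m)) * inv! (suc (suc m)))
      ≡⟨ cong (sgn (suc m) *_) (inv!-step (suc m)) ⟩
    sgn (suc m) * inv! (suc m)
      ≡⟨ negate (sgn (suc m) * inv! (suc m)) ⟩
    0ℚ - (- (sgn (suc m) * inv! (suc m)))  ∎
    where
    regroup : ∀ a s i → a * (- ((- 1ℚ * s) * i)) ≡ s * (a * i)
    regroup = solve-∀ ringℚ
    negate : ∀ x → x ≡ 0ℚ - (- x)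
    negate = solve-∀ ringℚ

  P : ℕ → Series
  P i = powS z i

  ∸-suc< : ∀ n j → j < n → n ∸ suc j < n
  ∸-suc< (suc n) zero    _          = ℕP.≤-refl
  ∸-suc< (suc n) (suc j) (ℕ.s≤s j<n) = ℕP.m<n⇒m<1+n (∸-suc< n j j<n)

  -- z has no constant term, so z^i starts at t^i
  P-vanish : ∀ i n → n < i → P i n ≡ 0ℚ
  P-vanish (suc i) n n<1+i = begin
    (z ⊛ P i) n                                   ≡⟨ ℚΣ.sum-first n _ ⟩
    0ℚ * P i n + sumℚ n (λ j → z (suc j) * P i (n ∸ suc j))
                                                  ≡⟨ cong₂ _+_ (ℚP.*-zeroˡ (P i n)) (ℚΣ.sum-zeros n _ higher) ⟩
    0ℚ + 0ℚ                                       ≡⟨ ℚP.+-identityˡ 0ℚ ⟩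
    0ℚ                                            ∎
    where
    higher : ∀ j → j < n → z (suc j) * P i (n ∸ suc j) ≡ 0ℚ
    higher j j<n = trans (cong (z (suc j) *_) (P-vanish i (n ∸ suc j)
                                               (ℕP.<-≤-trans (∸-suc< n j j<n) (ℕ.s≤s⁻¹ n<1+i))))
                         (ℚP.*-zeroʳ (z (suc j)))

  -- D z^i = i (z^{i-1} - z^i), from D z = 1 - z and the Leibniz rule
  D-P : ∀ i n → D (P i) n ≡ ℕ→ℚ i * (P (pred i) n - P i n)
  D-P zero    n = trans (ℚP.*-zeroʳ (ℕ→ℚ (suc n))) (sym (ℚP.*-zeroˡ (P 0 n - P 0 n)))
  D-P (suc i) n = begin
    D (z ⊛ P i) n                                     ≡⟨ product-rule z (P i) n ⟩
    (D z ⊛ P i) n + (z ⊛ D (P i)) n                   ≡⟨ cong₂ _+_ Dz-factor Dp-factor ⟩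
    (P i n - P (suc i) n) + ℕ→ℚ i * (P i n - P (suc i) n)
                                                      ≡⟨ collect (P i n - P (suc i) n) (ℕ→ℚ i) ⟩
    (1ℚ + ℕ→ℚ i) * (P i n - P (suc i) n)              ≡⟨ cong (_* (P i n - P (suc i) n)) (sym (ℕ→ℚ-+ 1 i)) ⟩
    ℕ→ℚ (suc i) * (P i n - P (suc i) n)               ∎
    where
    collect : ∀ d k → d + k * d ≡ (1ℚ + k) * d
    collect = solve-∀ ringℚ
    open Linear (⊛-linearˡ (P i) n) using () renaming (congL to congˡ; subtractive to subtractiveˡ)
    open Linear (⊛-linearʳ z n) using () renaming (congL to congʳ; homogeneous to homogeneousʳ; subtractive to subtractiveʳ)
    Dz-factor : (D z ⊛ P i) n ≡ P i n - P (suc i) n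
    Dz-factor = begin
      (D z ⊛ P i) n                                 ≡⟨ congˡ D-z ⟩
      ((λ j → oneS j - z j) ⊛ P i) n                ≡⟨ subtractiveˡ oneS z ⟩
      (oneS ⊛ P i) n - P (suc i) n                  ≡⟨ cong (_- P (suc i) n) (oneS-⊛ (P i) n) ⟩
      P i n - P (suc i) n                           ∎
    -- i z^{i-1} · z = i z^i also for i = 0
    i*z*P[i-1] : ∀ i → ℕ→ℚ i * (z ⊛ P (pred i)) n ≡ ℕ→ℚ i * P i n
    i*z*P[i-1] zero    = trans (ℚP.*-zeroˡ ((z ⊛ P 0) n)) (sym (ℚP.*-zeroˡ (P 0 n)))
    i*z*P[i-1] (suc i) = refl
    Dp-factor : (z ⊛ D (P i)) n ≡ ℕ→ℚ i * (P i n - P (suc i) n)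
    Dp-factor = begin
      (z ⊛ D (P i)) n                                        ≡⟨ congʳ (D-P i) ⟩
      (z ⊛ (λ j → ℕ→ℚ i * (P (pred i) j - P i j))) n          ≡⟨ homogeneousʳ (ℕ→ℚ i) (λ j → P (pred i) j - P i j) ⟩
      ℕ→ℚ i * (z ⊛ (λ j → P (pred i) j - P i j)) n            ≡⟨ cong (ℕ→ℚ i *_) (subtractiveʳ (P (pred i)) (P i)) ⟩
      ℕ→ℚ i * ((z ⊛ P (pred i)) n - P (suc i) n)             ≡⟨ ℚP.*-distribˡ-+ (ℕ→ℚ i) _ _ ⟩
      ℕ→ℚ i * (z ⊛ P (pred i)) n + ℕ→ℚ i * (- P (suc i) n)   ≡⟨ cong (_+ ℕ→ℚ i * (- P (suc i) n)) (i*z*P[i-1] i) ⟩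
      ℕ→ℚ i * P i n + ℕ→ℚ i * (- P (suc i) n)                ≡⟨ sym (ℚP.*-distribˡ-+ (ℕ→ℚ i) _ _) ⟩
      ℕ→ℚ i * (P i n - P (suc i) n)                          ∎

  -- F c = Σ_i c_i z^i, a series in t (z^i only contributes from t^i on)
  F : (ℕ → ℚ) → Series
  F c n = sumℚ (suc n) (λ i → P i n * c i)

  F-linear : ∀ n → Linear (λ c → F c n)
  F-linear n = weighted (suc n) (λ i → P i n) (λ i c → c i) evaluation

  -- the derivative in t, written in the coefficients with respect to z:
  -- D (Σ c_i z^i) = Σ c_i i (z^{i-1} - z^i) = Σ ((i+1) c_{i+1} - i c_i) z^i
  dz : (ℕ → ℚ) → (ℕ → ℚ)
  dz c i = ℕ→ℚ (suc i) * c (suc i) - ℕ→ℚ i * c i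

  D-F : ∀ c n → D (F c) n ≡ F (dz c) n
  D-F c n = begin
    ℕ→ℚ (suc n) * sumℚ (suc (suc n)) (λ i → P i (suc n) * c i)
      ≡⟨ sym (ℚΣ.sum-*ˡ (suc (suc n)) (ℕ→ℚ (suc n)) _) ⟩
    sumℚ (suc (suc n)) (λ i → ℕ→ℚ (suc n) * (P i (suc n) * c i))
      ≡⟨ ℚΣ.sum-cong (suc (suc n)) (λ i _ → trans (sym (ℚP.*-assoc (ℕ→ℚ (suc n)) (P i (suc n)) (c i)))
                                                   (cong (_* c i) (D-P i n))) ⟩
    sumℚ (suc (suc n)) (λ i → ℕ→ℚ i * (P (pred i) n - P i n) * c i)
      ≡⟨ ℚΣ.sum-cong (suc (suc n)) (λ i _ → expand (ℕ→ℚ i) (P (pred i) n) (P i n) (c i)) ⟩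
    sumℚ (suc (suc n)) (λ i → P (pred i) n * (ℕ→ℚ i * c i) + (- (P i n * (ℕ→ℚ i * c i))))
      ≡⟨ ℚΣ.sum-+ (suc (suc n)) _ _ ⟩
    sumℚ (suc (suc n)) (λ i → P (pred i) n * (ℕ→ℚ i * c i))
      + sumℚ (suc (suc n)) (λ i → - (P i n * (ℕ→ℚ i * c i)))
      ≡⟨ cong₂ _+_ shifted (trans (ℚΣ.sum-cong (suc (suc n)) (λ i _ → ℚP.neg-distribʳ-* (P i n) _)) unshifted) ⟩
    F (λ i → ℕ→ℚ (suc i) * c (suc i)) n + F (λ i → - (ℕ→ℚ i * c i)) n
      ≡⟨ sym (Linear.additive (F-linear n) _ _) ⟩
    F (dz c) n  ∎
    where
    expand : ∀ a p q r → a * (p - q) * r ≡ p * (a * r) + (- (q * (a * r)))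
    expand = solve-∀ ringℚ
    -- the i = 0 summand has the factor 0
    shifted : sumℚ (suc (suc n)) (λ i → P (pred i) n * (ℕ→ℚ i * c i)) ≡ F (λ i → ℕ→ℚ (suc i) * c (suc i)) n
    shifted = trans (ℚΣ.sum-first (suc n) _)
                    (trans (cong (_+ F (λ i → ℕ→ℚ (suc i) * c (suc i)) n)
                                 (trans (cong (P 0 n *_) (ℚP.*-zeroˡ (c 0))) (ℚP.*-zeroʳ (P 0 n))))
                           (ℚP.+-identityˡ _))
    -- the i = n+1 summand vanishes since z^{n+1} starts at t^{n+1}
    unshifted : sumℚ (suc (suc n)) (λ i → P i n * (- (ℕ→ℚ i * c i))) ≡ F (λ i → - (ℕ→ℚ i * c i)) n
    unshifted = trans (cong (F (λ i → - (ℕ→ℚ i * c i)) n +_)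
                            (trans (cong (_* last) (P-vanish (suc n) n ℕP.≤-refl)) (ℚP.*-zeroˡ last)))
                      (ℚP.+-identityʳ _)
      where last = - (ℕ→ℚ (suc n) * c (suc n))

  G : ℚ → (ℕ → ℚ) → Series
  G x c = expNeg x ⊛ F c

  G-linear : ∀ x n → Linear (λ c → G x c n)
  G-linear x n = weighted (suc n) (expNeg x) (λ i c → F c (n ∸ i)) (λ i → F-linear (n ∸ i))

  G-at-0 : ∀ x c → G x c 0 ≡ c 0
  G-at-0 x c = trans (ℚP.+-identityˡ _) (trans (ℚP.*-identityˡ _) (trans (ℚP.+-identityˡ _) (ℚP.*-identityˡ (c 0))))

  dG : ℚ → (ℕ → ℚ) → (ℕ → ℚ)
  dG x c i = dz c i - x * c i

  D-G : ∀ x c n → D (G x c) n ≡ G x (dG x c) n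
  D-G x c n = begin
    D (expNeg x ⊛ F c) n                              ≡⟨ product-rule (expNeg x) (F c) n ⟩
    (D (expNeg x) ⊛ F c) n + (expNeg x ⊛ D (F c)) n
      ≡⟨ cong₂ _+_ (trans (Linear.congL (⊛-linearˡ (F c) n) (D-expNeg x))
                          (Linear.homogeneous (⊛-linearˡ (F c) n) (- x) (expNeg x)))
                   (⊛-congʳ (expNeg x) (D (F c)) (F (dz c)) n (λ j _ → D-F c j)) ⟩
    (- x) * G x c n + G x (dz c) n                    ≡⟨ reorder (G x c n) (G x (dz c) n) x ⟩
    G x (dz c) n - x * G x c n                        ≡⟨ cong (λ y → G x (dz c) n - y) (sym (homogeneous x c)) ⟩
    G x (dz c) n - G x (λ i → x * c i) n              ≡⟨ sym (subtractive (dz c) (λ i → x * c i)) ⟩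
    G x (dG x c) n                                    ∎
    where
    open Linear (G-linear x n)
    reorder : ∀ g h x → (- x) * g + h ≡ h - x * g
    reorder = solve-∀ ringℚ

module Coefficients where

  open import Data.Nat
  open import Data.Nat.Properties
  open import Data.Nat.Tactic.RingSolver using (solve-∀)
  open import Relation.Binary.PropositionalEquality
  open ≡-Reasoning
  open Binomials
  open SurjectionNumbers

  cc : ℕ → ℕ → ℕ → ℕ
  cc m r i = binom i r * binom (i + m) m

  -- the closed form of the r-th term of B̂_n^k(m):  S(n, r) C(m+r, r)
  W : ℕ → ℕ → ℕ → ℕ
  W m n r = surj n r * binom (m + r) r

  cc-at-0 : ∀ m r → cc m r 0 ≡ W m 0 r
  cc-at-0 m zero    rewrite binom-diag m = refl
  cc-at-0 m (suc r) = refl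

  cc-step-0 : ∀ m i → suc i * cc m 0 (suc i) ≡ (i + m) * cc m 0 i + cc m 0 i
  cc-step-0 m i = begin
    suc i * (1 * binom (suc i + m) m)    ≡⟨ cong (suc i *_) (*-identityˡ _) ⟩
    suc i * binom (suc i + m) m          ≡⟨ binom-step i m ⟩
    suc (i + m) * binom (i + m) m        ≡⟨ ring (i + m) (binom (i + m) m) ⟩
    (i + m) * (1 * binom (i + m) m) + 1 * binom (i + m) m  ∎
    where ring : ∀ a b → suc a * b ≡ a * (1 * b) + 1 * b
          ring = solve-∀

  cc-step-suc : ∀ m r i → suc i * cc m (suc r) (suc i)
                          ≡ (i + m) * cc m (suc r) i + (suc (suc r) * cc m (suc r) i + (m + suc r) * cc m r i)
  cc-step-suc m r i = begin
    suc i * ((x + y) * B′)                          ≡⟨ ring₁ (suc i) x y B′ ⟩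
    (x + y) * (suc i * B′)                          ≡⟨ cong ((x + y) *_) (binom-step i m) ⟩
    (x + y) * (suc (i + m) * B)                     ≡⟨ ring₂ x y i m B ⟩
    (suc i * x) * B + (m * x + suc (i + m) * y) * B ≡⟨ cong (λ a → a * B + (m * x + suc (i + m) * y) * B) (absorption i r) ⟩
    (suc r * (x + y)) * B + (m * x + suc (i + m) * y) * B
                                                    ≡⟨ ring₃ x y i m r B ⟩
    (i + m) * (y * B) + (suc (suc r) * (y * B) + (m + suc r) * (x * B))  ∎
    where
    x y B B′ : ℕ
    x = binom i r
    y = binom i (suc r)
    B = binom (i + m) m
    B′ = binom (suc i + m) m
    ring₁ : ∀ a x y b → a * ((x + y) * b) ≡ (x + y) * (a * b)
    ring₁ = solve-∀
    ring₂ : ∀ x y i m B → (x + y) * (suc (i + m) * B) ≡ (suc i * x) * B + (m * x + suc (i + m) * y) * B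
    ring₂ = solve-∀
    ring₃ : ∀ x y i m r B → (suc r * (x + y)) * B + (m * x + suc (i + m) * y) * B
                            ≡ (i + m) * (y * B) + (suc (suc r) * (y * B) + (m + suc r) * (x * B))
    ring₃ = solve-∀

  W-step : ∀ m n r → suc (suc r) * W m n (suc r) + (m + suc r) * W m n r ≡ W m (suc n) (suc r)
  W-step m n r = begin
    suc (suc r) * (surj n (suc r) * B) + (m + suc r) * (surj n r * binom (m + r) r)
      ≡⟨ cong (suc (suc r) * (surj n (suc r) * B) +_) (ring₁ (m + suc r) (surj n r) (binom (m + r) r)) ⟩
    suc (suc r) * (surj n (suc r) * B) + surj n r * ((m + suc r) * binom (m + r) r)
      ≡⟨ cong (λ t → suc (suc r) * (surj n (suc r) * B) + surj n r * t) (absorption′ m r) ⟩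
    suc (suc r) * (surj n (suc r) * B) + surj n r * (suc r * B)
      ≡⟨ ring₂ (suc (suc r)) (surj n (suc r)) B (surj n r) (suc r) ⟩
    (suc (suc r) * surj n (suc r) + suc r * surj n r) * B
      ≡⟨ cong (_* B) (sym (surj-rec n (suc r))) ⟩
    surj (suc n) (suc r) * B  ∎
    where
    B : ℕ
    B = binom (m + suc r) (suc r)
    ring₁ : ∀ a b c → a * (b * c) ≡ b * (a * c)
    ring₁ = solve-∀
    ring₂ : ∀ s a B b t → s * (a * B) + b * (t * B) ≡ (s * a + t * b) * B
    ring₂ = solve-∀

  W-step-0 : ∀ m n → W m n 0 ≡ W m (suc n) 0
  W-step-0 m n = cong (_* binom (m + 0) 0) (trans (surj-zero n) (sym (surj-zero (suc n))))

module ClosedForm where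

  open import Data.Nat as ℕ using (ℕ; zero; suc; _≤_; _!)
  import Data.Nat.Properties as ℕP
  open import Data.Integer as ℤ using (+_)
  open import Data.Rational as ℚ using (ℚ; _+_; _*_; -_; _-_; 1ℚ)
  import Data.Rational.Properties as ℚP
  open import Relation.Binary.PropositionalEquality
  open import Tactic.RingSolver using (solve-∀)
  open ≡-Reasoning
  open import Defs
  open Naturals using (sumℕ; module ℕΣ)
  open Rationals
  open Binomials using (binom)
  import Data.Nat.Tactic.RingSolver as NSolver
  open SurjectionNumbers using (surj; pow-surj)
  open RisingFactorials using (stirling1-powers)
  open PowerSeries
  open Coefficients

  ℕ→ℚ-*+* : ∀ a x b y → ℕ→ℚ (a ℕ.* x ℕ.+ b ℕ.* y) ≡ ℕ→ℚ a * ℕ→ℚ x + ℕ→ℚ b * ℕ→ℚ y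
  ℕ→ℚ-*+* a x b y = trans (ℕ→ℚ-+ (a ℕ.* x) (b ℕ.* y)) (cong₂ _+_ (ℕ→ℚ-* a x) (ℕ→ℚ-* b y))

  dG-from-ℕ : ∀ m (c : ℕ → ℕ) i e → suc i ℕ.* c (suc i) ≡ (i ℕ.+ m) ℕ.* c i ℕ.+ e →
              dG (ℕ→ℚ m) (λ j → ℕ→ℚ (c j)) i ≡ ℕ→ℚ e
  dG-from-ℕ m c i e step = begin
    ℕ→ℚ (suc i) * ℕ→ℚ (c (suc i)) - ℕ→ℚ i * ℕ→ℚ (c i) - ℕ→ℚ m * ℕ→ℚ (c i)
      ≡⟨ cong (λ t → t - ℕ→ℚ i * ℕ→ℚ (c i) - ℕ→ℚ m * ℕ→ℚ (c i)) lhs ⟩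
    (ℕ→ℚ i + ℕ→ℚ m) * ℕ→ℚ (c i) + ℕ→ℚ e - ℕ→ℚ i * ℕ→ℚ (c i) - ℕ→ℚ m * ℕ→ℚ (c i)
      ≡⟨ cancel (ℕ→ℚ i) (ℕ→ℚ m) (ℕ→ℚ (c i)) (ℕ→ℚ e) ⟩
    ℕ→ℚ e  ∎
    where
    cancel : ∀ a b C E → (a + b) * C + E - a * C - b * C ≡ E
    cancel = solve-∀ ringℚ
    lhs : ℕ→ℚ (suc i) * ℕ→ℚ (c (suc i)) ≡ (ℕ→ℚ i + ℕ→ℚ m) * ℕ→ℚ (c i) + ℕ→ℚ e
    lhs = begin
      ℕ→ℚ (suc i) * ℕ→ℚ (c (suc i))               ≡⟨ sym (ℕ→ℚ-* (suc i) (c (suc i))) ⟩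
      ℕ→ℚ (suc i ℕ.* c (suc i))                   ≡⟨ cong ℕ→ℚ step ⟩
      ℕ→ℚ ((i ℕ.+ m) ℕ.* c i ℕ.+ e)               ≡⟨ ℕ→ℚ-+ ((i ℕ.+ m) ℕ.* c i) e ⟩
      ℕ→ℚ ((i ℕ.+ m) ℕ.* c i) + ℕ→ℚ e             ≡⟨ cong (_+ ℕ→ℚ e) (trans (ℕ→ℚ-* (i ℕ.+ m) (c i))
                                                                        (cong (_* ℕ→ℚ (c i)) (ℕ→ℚ-+ i m))) ⟩
      (ℕ→ℚ i + ℕ→ℚ m) * ℕ→ℚ (c i) + ℕ→ℚ e         ∎

  ccℚ : ℕ → ℕ → ℕ → ℚ
  ccℚ m r i = ℕ→ℚ (cc m r i)

  -- key lemma:  n! [t^n] e^{-mt} Σ_i C(i,r) C(i+m,m) (1-e^{-t})^i = S(n,r) C(m+r,r),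
  -- by induction on n using D (G_x c) = G_x (dG x c)
  G-cc : ∀ m n r → ℕ→ℚ (n !) * G (ℕ→ℚ m) (ccℚ m r) n ≡ ℕ→ℚ (W m n r)
  G-cc m zero r = trans (ℚP.*-identityˡ _) (trans (G-at-0 (ℕ→ℚ m) (ccℚ m r)) (cong ℕ→ℚ (cc-at-0 m r)))
  G-cc m (suc n) r = begin
    ℕ→ℚ (suc n !) * G x (ccℚ m r) (suc n)
      ≡⟨ cong (_* G x (ccℚ m r) (suc n)) (ℕ→ℚ-* (suc n) (n !)) ⟩
    ℕ→ℚ (suc n) * ℕ→ℚ (n !) * G x (ccℚ m r) (suc n)
      ≡⟨ swap (ℕ→ℚ (suc n)) (ℕ→ℚ (n !)) (G x (ccℚ m r) (suc n)) ⟩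
    ℕ→ℚ (n !) * D (G x (ccℚ m r)) n
      ≡⟨ cong (ℕ→ℚ (n !) *_) (D-G x (ccℚ m r) n) ⟩
    ℕ→ℚ (n !) * G x (dG x (ccℚ m r)) n
      ≡⟨ step r ⟩
    ℕ→ℚ (W m (suc n) r)  ∎
    where
    x : ℚ
    x = ℕ→ℚ m
    open Linear (G-linear x n)
    swap : ∀ a b g → a * b * g ≡ b * (a * g)
    swap = solve-∀ ringℚ
    step : ∀ r → ℕ→ℚ (n !) * G x (dG x (ccℚ m r)) n ≡ ℕ→ℚ (W m (suc n) r)
    step zero = begin
      ℕ→ℚ (n !) * G x (dG x (ccℚ m 0)) n   ≡⟨ cong (ℕ→ℚ (n !) *_) (congL (λ i → dG-from-ℕ m (cc m 0) i _ (cc-step-0 m i))) ⟩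
      ℕ→ℚ (n !) * G x (ccℚ m 0) n          ≡⟨ G-cc m n 0 ⟩
      ℕ→ℚ (W m n 0)                        ≡⟨ cong ℕ→ℚ (W-step-0 m n) ⟩
      ℕ→ℚ (W m (suc n) 0)                  ∎
    step (suc r) = begin
      ℕ→ℚ (n !) * G x (dG x (ccℚ m (suc r))) n
        ≡⟨ cong (ℕ→ℚ (n !) *_) (congL (λ i → trans (dG-from-ℕ m (cc m (suc r)) i _ (cc-step-suc m r i))
                                                   (ℕ→ℚ-*+* (suc (suc r)) (cc m (suc r) i) (m ℕ.+ suc r) (cc m r i)))) ⟩
      ℕ→ℚ (n !) * G x (λ i → a * ccℚ m (suc r) i + b * ccℚ m r i) n
        ≡⟨ cong (ℕ→ℚ (n !) *_) (trans (additive _ _) (cong₂ _+_ (homogeneous a _) (homogeneous b _))) ⟩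
      ℕ→ℚ (n !) * (a * G x (ccℚ m (suc r)) n + b * G x (ccℚ m r) n)
        ≡⟨ distrib (ℕ→ℚ (n !)) a (G x (ccℚ m (suc r)) n) b (G x (ccℚ m r) n) ⟩
      a * (ℕ→ℚ (n !) * G x (ccℚ m (suc r)) n) + b * (ℕ→ℚ (n !) * G x (ccℚ m r) n)
        ≡⟨ cong₂ (λ u v → a * u + b * v) (G-cc m n (suc r)) (G-cc m n r) ⟩
      a * ℕ→ℚ (W m n (suc r)) + b * ℕ→ℚ (W m n r)
        ≡⟨ sym (ℕ→ℚ-*+* (suc (suc r)) (W m n (suc r)) (m ℕ.+ suc r) (W m n r)) ⟩
      ℕ→ℚ (suc (suc r) ℕ.* W m n (suc r) ℕ.+ (m ℕ.+ suc r) ℕ.* W m n r)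
        ≡⟨ cong ℕ→ℚ (W-step m n r) ⟩
      ℕ→ℚ (W m (suc n) (suc r))  ∎
      where
      a b : ℚ
      a = ℕ→ℚ (suc (suc r))
      b = ℕ→ℚ (m ℕ.+ suc r)
      distrib : ∀ f a g b h → f * (a * g + b * h) ≡ a * (f * g) + b * (f * h)
      distrib = solve-∀ ringℚ

  -- for negative index, Li_{-t}(z)/z = Σ_i (i+1)^t z^i, so B_n^{(-t)}(x) = n! [t^n] G_x((i+1)^t)
  invPow-neg : ∀ i t → invPow (suc i) (ℤ.- (+ t)) ≡ ℕ→ℚ (suc i ℕ.^ t)
  invPow-neg i zero    = refl
  invPow-neg i (suc t) = refl

  polyBernoulli-neg : ∀ n t x → polyBernoulli n (ℤ.- (+ t)) x ≡ ℕ→ℚ (n !) * G x (λ i → ℕ→ℚ (suc i ℕ.^ t)) n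
  polyBernoulli-neg n t x = cong (ℕ→ℚ (n !) *_) (⊛-congʳ (expNeg x) _ _ n truncation)
    where
    c : ℕ → ℚ
    c i = ℕ→ℚ (suc i ℕ.^ t)
    -- up to t^n, the truncation of Li_{-t}(z)/z at z^n is F c
    truncation : ∀ j → j ≤ n → liOverZTrunc (ℤ.- (+ t)) n j ≡ F c j
    truncation j j≤n = begin
      sumℚ (suc n) (λ i → P i j * invPow (suc i) (ℤ.- (+ t)))
        ≡⟨ ℚΣ.sum-cong (suc n) (λ i _ → cong (P i j *_) (invPow-neg i t)) ⟩
      sumℚ (suc n) (λ i → P i j * c i)
        ≡⟨ ℚΣ.sum-tail _ (ℕ.s≤s j≤n) (λ i j<i _ → trans (cong (_* c i) (P-vanish i j j<i)) (ℚP.*-zeroˡ (c i))) ⟩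
      F c j  ∎

  stirling-coefficient : ∀ k m i →
    sumℚ (suc m) (λ j → (inv! m * ℕ→ℚ (stirling1 m j)) * ℕ→ℚ (suc i ℕ.^ (k ℕ.+ j)))
    ≡ ℕ→ℚ (suc i ℕ.^ k ℕ.* binom (i ℕ.+ m) m)
  stirling-coefficient k m i = begin
    sumℚ (suc m) (λ j → (inv! m * ℕ→ℚ (stirling1 m j)) * ℕ→ℚ (suc i ℕ.^ (k ℕ.+ j)))
      ≡⟨ ℚΣ.sum-cong (suc m) (λ j _ → trans (ℚP.*-assoc (inv! m) _ _)
                                            (cong (inv! m *_) (sym (ℕ→ℚ-* (stirling1 m j) _)))) ⟩
    sumℚ (suc m) (λ j → inv! m * ℕ→ℚ (stirling1 m j ℕ.* suc i ℕ.^ (k ℕ.+ j)))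
      ≡⟨ trans (ℚΣ.sum-*ˡ (suc m) (inv! m) _) (cong (inv! m *_) (sym (ℕ→ℚ-sum (suc m) _))) ⟩
    inv! m * ℕ→ℚ (sumℕ (suc m) (λ j → stirling1 m j ℕ.* suc i ℕ.^ (k ℕ.+ j)))
      ≡⟨ cong (λ t → inv! m * ℕ→ℚ t) (stirling1-powers k m i) ⟩
    inv! m * ℕ→ℚ (m ! ℕ.* X)
      ≡⟨ cong (inv! m *_) (ℕ→ℚ-* (m !) X) ⟩
    inv! m * (ℕ→ℚ (m !) * ℕ→ℚ X)
      ≡⟨ regroup (inv! m) (ℕ→ℚ (m !)) (ℕ→ℚ X) ⟩
    (ℕ→ℚ (m !) * inv! m) * ℕ→ℚ X
      ≡⟨ cong (_* ℕ→ℚ X) (n!*inv!n m) ⟩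
    1ℚ * ℕ→ℚ X
      ≡⟨ ℚP.*-identityˡ _ ⟩
    ℕ→ℚ X  ∎
    where
    X : ℕ
    X = suc i ℕ.^ k ℕ.* binom (i ℕ.+ m) m
    regroup : ∀ a b c → a * (b * c) ≡ (b * a) * c
    regroup = solve-∀ ringℚ

  power-expansion : ∀ k m i → ℕ→ℚ (suc i ℕ.^ k ℕ.* binom (i ℕ.+ m) m)
                              ≡ sumℚ (suc k) (λ r → ℕ→ℚ (surj k r) * ccℚ m r i)
  power-expansion k m i = begin
    ℕ→ℚ (suc i ℕ.^ k ℕ.* B)
      ≡⟨ cong (λ t → ℕ→ℚ (t ℕ.* B)) (pow-surj k i) ⟩
    ℕ→ℚ (sumℕ (suc k) (λ r → surj k r ℕ.* binom i r) ℕ.* B)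
      ≡⟨ cong ℕ→ℚ (trans (ℕP.*-comm _ B) (sym (ℕΣ.sum-*ˡ (suc k) B _))) ⟩
    ℕ→ℚ (sumℕ (suc k) (λ r → B ℕ.* (surj k r ℕ.* binom i r)))
      ≡⟨ ℕ→ℚ-sum (suc k) _ ⟩
    sumℚ (suc k) (λ r → ℕ→ℚ (B ℕ.* (surj k r ℕ.* binom i r)))
      ≡⟨ ℚΣ.sum-cong (suc k) (λ r _ → trans (cong ℕ→ℚ (regroup B (surj k r) (binom i r)))
                                            (ℕ→ℚ-* (surj k r) (cc m r i))) ⟩
    sumℚ (suc k) (λ r → ℕ→ℚ (surj k r) * ccℚ m r i)  ∎
    where
    B : ℕ
    B = binom (i ℕ.+ m) m
    regroup : ∀ b a c → b ℕ.* (a ℕ.* c) ≡ a ℕ.* (c ℕ.* b)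
    regroup = NSolver.solve-∀

  Bhat-closed-form : ∀ n k m → Bhat n k m ≡ ℕ→ℚ (sumℕ (suc k) (λ r → surj k r ℕ.* W m n r))
  Bhat-closed-form n k m = begin
    inv! m * sumℚ (suc m) (λ j → ℕ→ℚ (stirling1 m j) * polyBernoulli n (ℤ.- (+ (k ℕ.+ j))) x)
      ≡⟨ cong (inv! m *_) (ℚΣ.sum-cong (suc m) (λ j _ → cong (ℕ→ℚ (stirling1 m j) *_) (polyBernoulli-neg n (k ℕ.+ j) x))) ⟩
    inv! m * sumℚ (suc m) (λ j → ℕ→ℚ (stirling1 m j) * (N * G x (c (k ℕ.+ j)) n))
      ≡⟨ sym (ℚΣ.sum-*ˡ (suc m) (inv! m) _) ⟩
    sumℚ (suc m) (λ j → inv! m * (ℕ→ℚ (stirling1 m j) * (N * G x (c (k ℕ.+ j)) n)))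
      ≡⟨ ℚΣ.sum-cong (suc m) (λ j _ → regroup (inv! m) (ℕ→ℚ (stirling1 m j)) N (G x (c (k ℕ.+ j)) n)) ⟩
    sumℚ (suc m) (λ j → N * (a j * G x (c (k ℕ.+ j)) n))
      ≡⟨ ℚΣ.sum-*ˡ (suc m) N _ ⟩
    N * sumℚ (suc m) (λ j → a j * G x (c (k ℕ.+ j)) n)
      ≡⟨ cong (N *_) (sym (combination (suc m) a (λ j → c (k ℕ.+ j)))) ⟩
    N * G x (λ i → sumℚ (suc m) (λ j → a j * c (k ℕ.+ j) i)) n
      ≡⟨ cong (N *_) (congL (λ i → trans (stirling-coefficient k m i) (power-expansion k m i))) ⟩
    N * G x (λ i → sumℚ (suc k) (λ r → A r * ccℚ m r i)) n
      ≡⟨ cong (N *_) (combination (suc k) A (ccℚ m)) ⟩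
    N * sumℚ (suc k) (λ r → A r * G x (ccℚ m r) n)
      ≡⟨ sym (ℚΣ.sum-*ˡ (suc k) N _) ⟩
    sumℚ (suc k) (λ r → N * (A r * G x (ccℚ m r) n))
      ≡⟨ ℚΣ.sum-cong (suc k) (λ r _ → trans (swap N (A r) _) (cong (A r *_) (G-cc m n r))) ⟩
    sumℚ (suc k) (λ r → A r * ℕ→ℚ (W m n r))
      ≡⟨ trans (ℚΣ.sum-cong (suc k) (λ r _ → sym (ℕ→ℚ-* (surj k r) (W m n r)))) (sym (ℕ→ℚ-sum (suc k) _)) ⟩
    ℕ→ℚ (sumℕ (suc k) (λ r → surj k r ℕ.* W m n r))  ∎
    where
    x N : ℚ
    x = ℕ→ℚ m
    N = ℕ→ℚ (n !)
    open Linear (G-linear x n)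
    c : ℕ → ℕ → ℚ
    c t i = ℕ→ℚ (suc i ℕ.^ t)
    a : ℕ → ℚ
    a j = inv! m * ℕ→ℚ (stirling1 m j)
    A : ℕ → ℚ
    A r = ℕ→ℚ (surj k r)
    regroup : ∀ i s N g → i * (s * (N * g)) ≡ N * ((i * s) * g)
    regroup = solve-∀ ringℚ
    swap : ∀ a b c → a * (b * c) ≡ b * (a * c)
    swap = solve-∀ ringℚ

module Recurrence where

  open import Data.Nat
  open import Data.Nat.Properties
  open import Data.Nat.Tactic.RingSolver using (solve-∀)
  open import Data.Empty using (⊥-elim)
  open import Relation.Nullary using (yes; no)
  open import Relation.Binary.PropositionalEquality
  open ≡-Reasoning
  open Naturals
  open Binomials
  open SurjectionNumbers
  open Coefficients using (W)

  sum-min : ∀ a k (f : ℕ → ℕ) → (∀ r → a < r → f r ≡ 0) → sumℕ (suc (a ⊓ k)) f ≡ sumℕ (suc k) f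
  sum-min a k f vanish = sym (ℕΣ.sum-tail f (s≤s (m⊓n≤n a k)) vanish′)
    where
    vanish′ : ∀ i → suc (a ⊓ k) ≤ i → i < suc k → f i ≡ 0
    vanish′ i a⊓k<i i≤k with a <? i
    ... | yes a<i = vanish i a<i
    ... | no  a≮i = ⊥-elim (<-irrefl refl (<-≤-trans a⊓k<i (⊓-glb (≮⇒≥ a≮i) (s≤s⁻¹ i≤k))))

  module _ (cnt : ℕ → ℕ → ℕ → ℕ → ℕ) (n k m : ℕ)
           (formula : ∀ a r → cnt a k m r ≡ surj a r * (surj k r * compositions m r)) where

    -- pairs whose first component is R^*:  Σ_r (r+1) S(n, r) S(k, r) C(m+r, r)
    extra-pair : sumℕ (suc (n ⊓ k)) (λ r → (r + 1) * cnt n k m r) ≡ sumℕ (suc k) (λ r → suc r * surj k r * W m n r)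
    extra-pair = trans (sum-min n k _ vanish)
                       (ℕΣ.sum-cong (suc k) (λ r _ → trans (cong ((r + 1) *_) (formula n r)) (regroup r)))
      where
      vanish : ∀ r → n < r → (r + 1) * cnt n k m r ≡ 0
      vanish r n<r rewrite formula n r | surj-vanish n r n<r = *-zeroʳ (r + 1)
      regroup : ∀ r → (r + 1) * (surj n r * (surj k r * compositions m r)) ≡ suc r * surj k r * W m n r
      regroup r rewrite compositions≡binom m r = ring r (surj n r) (surj k r) (binom (m + r) r)
        where ring : ∀ r a b c → (r + 1) * (a * (b * c)) ≡ suc r * b * (a * c)
              ring = solve-∀

    -- pairs whose first ordinary pair has a row block of j+1 elements:
    --   Σ_j C(n, j+1) Σ_r (m+r+1) (formula at n-1-j) = Σ_r (r+1) S(k, r) S(n, r+1) C(m+r+1, r+1)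
    first-pair : sumℕ n (λ i → binom n (suc i) * sumℕ (suc ((n ∸ suc i) ⊓ k)) (λ r → (m + r + 1) * cnt (n ∸ suc i) k m r))
                 ≡ sumℕ (suc k) (λ r → suc r * surj k r * W m n (suc r))
    first-pair = begin
      sumℕ n (λ i → binom n (suc i) * sumℕ (suc ((n ∸ suc i) ⊓ k)) (λ r → (m + r + 1) * cnt (n ∸ suc i) k m r))
        ≡⟨ ℕΣ.sum-cong n (λ i _ → trans (cong (binom n (suc i) *_) (inner i))
                                        (sym (ℕΣ.sum-*ˡ (suc k) (binom n (suc i)) _))) ⟩
      sumℕ n (λ i → sumℕ (suc k) (λ r → binom n (suc i) * (weight r * surj (n ∸ suc i) r)))
        ≡⟨ ℕΣ.sum-swap n (suc k) _ ⟩
      sumℕ (suc k) (λ r → sumℕ n (λ i → binom n (suc i) * (weight r * surj (n ∸ suc i) r)))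
        ≡⟨ ℕΣ.sum-cong (suc k) (λ r _ → trans (ℕΣ.sum-cong n (λ i _ → swap (binom n (suc i)) (weight r) _))
                                              (ℕΣ.sum-*ˡ n (weight r) _)) ⟩
      sumℕ (suc k) (λ r → weight r * sumℕ n (λ i → binom n (suc i) * surj (n ∸ suc i) r))
        ≡⟨ ℕΣ.sum-cong (suc k) (λ r _ → cong (weight r *_) (surj-by-block n r)) ⟩
      sumℕ (suc k) (λ r → weight r * surj n (suc r))
        ≡⟨ ℕΣ.sum-cong (suc k) (λ r _ → absorb r) ⟩
      sumℕ (suc k) (λ r → suc r * surj k r * W m n (suc r))  ∎
      where
      weight : ℕ → ℕ
      weight r = (m + r + 1) * (surj k r * compositions m r)
      swap : ∀ a b c → a * (b * c) ≡ b * (a * c)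
      swap = solve-∀
      inner : ∀ i → sumℕ (suc ((n ∸ suc i) ⊓ k)) (λ r → (m + r + 1) * cnt (n ∸ suc i) k m r)
                    ≡ sumℕ (suc k) (λ r → weight r * surj (n ∸ suc i) r)
      inner i = trans (sum-min (n ∸ suc i) k _ vanish) (ℕΣ.sum-cong (suc k) (λ r _ → regroup r))
        where
        vanish : ∀ r → n ∸ suc i < r → (m + r + 1) * cnt (n ∸ suc i) k m r ≡ 0
        vanish r lt rewrite formula (n ∸ suc i) r | surj-vanish (n ∸ suc i) r lt = *-zeroʳ (m + r + 1)
        regroup : ∀ r → (m + r + 1) * cnt (n ∸ suc i) k m r ≡ weight r * surj (n ∸ suc i) r
        regroup r rewrite formula (n ∸ suc i) r = ring (m + r + 1) (surj (n ∸ suc i) r) (surj k r * compositions m r)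
          where ring : ∀ a b c → a * (b * c) ≡ a * c * b
                ring = solve-∀
      absorb : ∀ r → weight r * surj n (suc r) ≡ suc r * surj k r * W m n (suc r)
      absorb r rewrite compositions≡binom m r = begin
        (m + r + 1) * (surj k r * binom (m + r) r) * surj n (suc r)
          ≡⟨ ring₁ m r (surj k r) (binom (m + r) r) (surj n (suc r)) ⟩
        surj k r * surj n (suc r) * ((m + suc r) * binom (m + r) r)
          ≡⟨ cong (surj k r * surj n (suc r) *_) (absorption′ m r) ⟩
        surj k r * surj n (suc r) * (suc r * binom (m + suc r) (suc r))
          ≡⟨ ring₂ (surj k r) (surj n (suc r)) r (binom (m + suc r) (suc r)) ⟩
        suc r * surj k r * W m n (suc r)  ∎
        where
        ring₁ : ∀ m r a b c → (m + r + 1) * (a * b) * c ≡ a * c * ((m + suc r) * b)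
        ring₁ = solve-∀
        ring₂ : ∀ a c r b → a * c * (suc r * b) ≡ suc r * a * (c * b)
        ring₂ = solve-∀

    -- Theorem 4 in ℕ: splitting  S(k+1, r) = (r+1) S(k, r) + r S(k, r-1)  in the closed form
    recurrence : sumℕ (suc (suc k)) (λ r → surj (suc k) r * W m n r)
                 ≡ sumℕ n (λ i → binom n (suc i) * sumℕ (suc ((n ∸ suc i) ⊓ k)) (λ r → (m + r + 1) * cnt (n ∸ suc i) k m r))
                   + sumℕ (suc (n ⊓ k)) (λ r → (r + 1) * cnt n k m r)
    recurrence = begin
      sumℕ (suc (suc k)) (λ r → surj (suc k) r * W m n r)
        ≡⟨ surj-rec-sum k (W m n) ⟩
      sumℕ (suc k) (λ r → suc r * surj k r * (W m n r + W m n (suc r)))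
        ≡⟨ ℕΣ.sum-cong (suc k) (λ r _ → trans (*-distribˡ-+ (suc r * surj k r) (W m n r) (W m n (suc r))) (+-comm (suc r * surj k r * W m n r) _)) ⟩
      sumℕ (suc k) (λ r → suc r * surj k r * W m n (suc r) + suc r * surj k r * W m n r)
        ≡⟨ ℕΣ.sum-+ (suc k) _ _ ⟩
      sumℕ (suc k) (λ r → suc r * surj k r * W m n (suc r)) + sumℕ (suc k) (λ r → suc r * surj k r * W m n r)
        ≡⟨ sym (cong₂ _+_ first-pair extra-pair) ⟩
      sumℕ n (λ i → binom n (suc i) * sumℕ (suc ((n ∸ suc i) ⊓ k)) (λ r → (m + r + 1) * cnt (n ∸ suc i) k m r))
        + sumℕ (suc (n ⊓ k)) (λ r → (r + 1) * cnt n k m r)  ∎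


open import Defs
open import Data.Nat using (ℕ; suc; _∸_; _⊓_; _<_; _+_)
open import Data.Nat.Combinatorics using (_C_)
open import Data.Rational using (ℚ; _*_)
open import Data.Fin using (Fin)
open import Function.Bundles using (_↔_)
open import Relation.Binary.PropositionalEquality using (_≡_)

import Data.Nat as ℕ
import Data.Rational as ℚ
open import Relation.Binary.PropositionalEquality using (cong; cong₂; sym; trans; module ≡-Reasoning)
open ≡-Reasoning
open Naturals using (sumℕ)
open Rationals using (ℕ→ℚ-+; ℕ→ℚ-dot; module ℚΣ)
open Binomials using (binom; binom≡C)
open SurjectionNumbers using (surj)
open Coefficients using (W)
open Counting using (barredCallan-count)
open ClosedForm using (Bhat-closed-form)
open Recurrence using (recurrence)

mainTheorem4 :
    (cnt : ℕ → ℕ → ℕ → ℕ → ℕ) →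
    (∀ n k m r → Fin (cnt n k m r) ↔ BarredCallan n k m r) →
    ∀ n k m → 0 < n → 0 < k →
    Bhat n k m ≡
      Data.Rational._+_
        (sumℚ n (λ i → ℕ→ℚ (n C suc i) *
           sumℚ (suc ((n ∸ suc i) ⊓ (k ∸ 1))) (λ r →
             ℕ→ℚ (m + r + 1) * ℕ→ℚ (cnt (n ∸ suc i) (k ∸ 1) m r))))
        (sumℚ (suc (n ⊓ (k ∸ 1))) (λ r → ℕ→ℚ (r + 1) * ℕ→ℚ (cnt n (k ∸ 1) m r)))
mainTheorem4 cnt Fin-cnt n (suc k) m _ _ = begin
  Bhat n (suc k) m
    ≡⟨ Bhat-closed-form n (suc k) m ⟩
  ℕ→ℚ (sumℕ (suc (suc k)) (λ r → surj (suc k) r ℕ.* W m n r))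
    ≡⟨ cong ℕ→ℚ (recurrence cnt n k m (λ a r → barredCallan-count cnt Fin-cnt a k m r)) ⟩
  ℕ→ℚ (first ℕ.+ extra)
    ≡⟨ ℕ→ℚ-+ first extra ⟩
  ℚ._+_ (ℕ→ℚ first) (ℕ→ℚ extra)
    ≡⟨ sym (cong₂ ℚ._+_ first-in-ℚ (ℕ→ℚ-dot (suc (n ⊓ k)) (λ r → r + 1) (cnt n k m))) ⟩
  ℚ._+_ (sumℚ n (λ i → ℕ→ℚ (n C suc i) * inner i)) (sumℚ (suc (n ⊓ k)) (λ r → ℕ→ℚ (r + 1) * ℕ→ℚ (cnt n k m r)))  ∎
  where
  innerℕ : ℕ → ℕ
  innerℕ i = sumℕ (suc ((n ∸ suc i) ⊓ k)) (λ r → (m + r + 1) ℕ.* cnt (n ∸ suc i) k m r)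
  inner : ℕ → ℚ
  inner i = sumℚ (suc ((n ∸ suc i) ⊓ k)) (λ r → ℕ→ℚ (m + r + 1) * ℕ→ℚ (cnt (n ∸ suc i) k m r))
  first extra : ℕ
  first = sumℕ n (λ i → binom n (suc i) ℕ.* innerℕ i)
  extra = sumℕ (suc (n ⊓ k)) (λ r → (r + 1) ℕ.* cnt n k m r)
  first-in-ℚ : sumℚ n (λ i → ℕ→ℚ (n C suc i) * inner i) ≡ ℕ→ℚ first
  first-in-ℚ = trans
    (ℚΣ.sum-cong n (λ i _ → cong₂ _*_ (cong ℕ→ℚ (sym (binom≡C n (suc i))))
                                                 (ℕ→ℚ-dot (suc ((n ∸ suc i) ⊓ k)) (λ r → m + r + 1) (cnt (n ∸ suc i) k m))))
    (ℕ→ℚ-dot n (λ i → binom n (suc i)) innerℕ)
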